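{- Let $G$ be a snake graph coloured so that all turns are black, equipped with the weighting $w$ that is $1$ on every edge of the upper and lower boundary and alternates in sign, starting with $+1$ on the start edge, along the remaining edges (start edge, the edges shared by consecutive tiles in order, end edge). Let $B$ be the weighted bipartite adjacency matrix. If the black vertices are ordered by first listing those of the upper boundary in the order they occur along it and then those of the lower boundary in the order they occur along it, then $$BB^T=\begin{pmatrix}B_1&0\\0&B_2\end{pmatrix},$$ where $B_1$ and $B_2$ are indexed by the black vertices of the upper and lower boundary, respectively, and are tridiagonal matrices all of whose entries directly above and below the main diagonal equal $1$.
   Context: A snake graph is a plane graph formed by a finite sequence of unit square tiles $T_1,\dots,T_N$, each $T_{i+1}$ placed immediately to the right of or on top of $T_i$, consecutive tiles sharing exactly one edge; vertices are coloured black and white with adjacent vertices of different colours. A vertex is a turn if it has exactly $2$ or exactly $4$ neighbours and is neither the lower-right, lower-left nor upper-left vertex of $T_1$, nor the upper-left, upper-right or lower-right vertex of $T_N$. For $N\geq2$, the start edge is the edge of $T_1$ joining the two vertices of $T_1$ not in $T_2$ and the end edge is defined analogously for $T_N$; removing these from the cycle of edges bounding the unbounded face leaves two disjoint paths, the upper and lower boundary (the one containing the lower-left vertex of $T_1$ is the upper boundary if $T_2$ is above $T_1$, otherwise the lower boundary); for $N=1$ they are the top and bottom edges and the remaining edges are the left (start) and right edges. $B$ has rows indexed by black vertices and columns by white vertices, entry $w(e)$ if joined by edge $e$, else $0$. -}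

module Defs where

open import Data.Nat using (ℕ; zero; suc; _<_; _+_)
import Data.Nat.Properties as ℕP
open import Data.Bool using (Bool; true; false)
import Data.Bool.Properties as BoolP
open import Data.Integer using (ℤ; +_; -_; 0ℤ; 1ℤ) renaming (_+_ to _+ℤ_; _*_ to _*ℤ_)
open import Data.List using (List; []; _∷_; _++_; map; concatMap; filter; foldr; length; lookup; deduplicate)
open import Data.List.Membership.Propositional using (_∈_; _∉_)
open import Data.List.Relation.Unary.Unique.Propositional using (Unique)
open import Data.List.Relation.Unary.All using (All)
open import Data.List.Relation.Unary.Any using (any?)
open import Data.Maybe using (Maybe; just; nothing)
open import Data.Fin using (Fin; toℕ; splitAt)
open import Data.Sum using (_⊎_; inj₁; inj₂)
open import Data.Product using (Σ; _×_; _,_; proj₁; proj₂; Σ-syntax)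
import Data.Product.Properties as ProdP
open import Relation.Binary.PropositionalEquality using (_≡_; _≢_; refl; cong)
open import Relation.Binary.Definitions using (DecidableEquality)
open import Relation.Nullary using (Dec; yes; no; ¬_)
open import Relation.Nullary.Decidable using (_⊎-dec_; _×-dec_)

-- A snake graph with N = suc (length ds) tiles T₁ … T_N is given by the
-- list ds of the N-1 placement directions: the i-th entry says whether
-- T_{i+1} is placed to the right (R) of or on top (U) of T_i.
-- Tiles are unit squares in ℕ × ℕ; T₁ has lower-left corner (0,0).

data Dir : Set where
  R U : Dir

Vertex : Set
Vertex = ℕ × ℕ

_≟V_ : DecidableEquality Vertex
_≟V_ = ProdP.≡-dec ℕP._≟_ ℕP._≟_

data Edge : Set where
  hor : ℕ → ℕ → Edge
  ver : ℕ → ℕ → Edge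

_≟E_ : DecidableEquality Edge
hor x y ≟E hor x' y' with x ℕP.≟ x' | y ℕP.≟ y'
... | yes refl | yes refl = yes refl
... | no p | _ = no λ { refl → p refl }
... | yes _ | no q = no λ { refl → q refl }
hor _ _ ≟E ver _ _ = no λ ()
ver _ _ ≟E hor _ _ = no λ ()
ver x y ≟E ver x' y' with x ℕP.≟ x' | y ℕP.≟ y'
... | yes refl | yes refl = yes refl
... | no p | _ = no λ { refl → p refl }
... | yes _ | no q = no λ { refl → q refl }

endpoints : Edge → Vertex × Vertex
endpoints (hor x y) = (x , y) , (suc x , y)
endpoints (ver x y) = (x , y) , (x , suc y)

tilesFrom : Vertex → List Dir → List Vertex
tilesFrom p [] = p ∷ []
tilesFrom (x , y) (R ∷ ds) = (x , y) ∷ tilesFrom (suc x , y) ds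
tilesFrom (x , y) (U ∷ ds) = (x , y) ∷ tilesFrom (x , suc y) ds

tiles : List Dir → List Vertex
tiles = tilesFrom (0 , 0)

lastTileFrom : Vertex → List Dir → Vertex
lastTileFrom p [] = p
lastTileFrom (x , y) (R ∷ ds) = lastTileFrom (suc x , y) ds
lastTileFrom (x , y) (U ∷ ds) = lastTileFrom (x , suc y) ds

lastTile : List Dir → Vertex
lastTile = lastTileFrom (0 , 0)

firstDir : List Dir → Maybe Dir
firstDir [] = nothing
firstDir (d ∷ _) = just d

lastDir : List Dir → Maybe Dir
lastDir [] = nothing
lastDir (d ∷ []) = just d
lastDir (_ ∷ d ∷ ds) = lastDir (d ∷ ds)

tileEdges : Vertex → List Edge
tileEdges (x , y) = hor x y ∷ hor x (suc y) ∷ ver x y ∷ ver (suc x) y ∷ []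

tileCorners : Vertex → List Vertex
tileCorners (x , y) = (x , y) ∷ (suc x , y) ∷ (x , suc y) ∷ (suc x , suc y) ∷ []

-- the edges of the snake graph (sides of tiles; may list an edge twice)
edges : List Dir → List Edge
edges ds = concatMap tileEdges (tiles ds)

vertices : List Dir → List Vertex
vertices ds = deduplicate _≟V_ (concatMap tileCorners (tiles ds))

Joins : Edge → Vertex → Vertex → Set
Joins e u v = (endpoints e ≡ (u , v)) ⊎ (endpoints e ≡ (v , u))

joins? : ∀ e u v → Dec (Joins e u v)
joins? e u v = ProdP.≡-dec _≟V_ _≟V_ (endpoints e) (u , v)
           ⊎-dec ProdP.≡-dec _≟V_ _≟V_ (endpoints e) (v , u)

Adjacent : List Dir → Vertex → Vertex → Set
Adjacent ds u v = Data.List.Relation.Unary.Any.Any (λ e → Joins e u v) (edges ds)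

adjacent? : ∀ ds u v → Dec (Adjacent ds u v)
adjacent? ds u v = any? (λ e → joins? e u v) (edges ds)

neighbours : List Dir → Vertex → List Vertex
neighbours ds v = filter (λ u → adjacent? ds v u) (vertices ds)

degree : List Dir → Vertex → ℕ
degree ds v = length (neighbours ds v)

excluded : List Dir → List Vertex
excluded ds with lastTile ds
... | (x , y) = (1 , 0) ∷ (0 , 0) ∷ (0 , 1)
              ∷ (x , suc y) ∷ (suc x , suc y) ∷ (suc x , y) ∷ []

Turn : List Dir → Vertex → Set
Turn ds v = v ∈ vertices ds
          × (degree ds v ≡ 2 ⊎ degree ds v ≡ 4)
          × v ∉ excluded ds

-- Colourings: col v ≡ true means v is black, false means white.

ProperColouring : List Dir → (Vertex → Bool) → Set
ProperColouring ds col =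
  ∀ e → e ∈ edges ds → col (proj₁ (endpoints e)) ≢ col (proj₂ (endpoints e))

AllTurnsBlack : List Dir → (Vertex → Bool) → Set
AllTurnsBlack ds col = ∀ v → Turn ds v → col v ≡ true

startEdge : List Dir → Edge
startEdge (U ∷ _) = hor 0 0
startEdge _       = ver 0 0        -- T₂ right of T₁ or N = 1: left edge of T₁

sharedEdgesFrom : Vertex → List Dir → List Edge
sharedEdgesFrom p [] = []
sharedEdgesFrom (x , y) (R ∷ ds) = ver (suc x) y ∷ sharedEdgesFrom (suc x , y) ds
sharedEdgesFrom (x , y) (U ∷ ds) = hor x (suc y) ∷ sharedEdgesFrom (x , suc y) ds

endEdge : List Dir → Edge
endEdge ds with lastDir ds | lastTile ds
... | just U | (x , y) = hor x (suc y)
... | _      | (x , y) = ver (suc x) y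

signedSequence : List Dir → List Edge
signedSequence ds = startEdge ds ∷ (sharedEdgesFrom (0 , 0) ds ++ (endEdge ds ∷ []))

sign : ℕ → ℤ
sign zero = 1ℤ
sign (suc k) = - sign k

indexOf : Edge → List Edge → Maybe ℕ
indexOf e [] = nothing
indexOf e (f ∷ fs) with e ≟E f
... | yes _ = just 0
... | no _ with indexOf e fs
...   | just k = just (suc k)
...   | nothing = nothing

-- the weighting w: alternating signs +1,-1,… along signedSequence,
-- 1 on all other edges (= the edges of the upper and lower boundary)
weight : List Dir → Edge → ℤ
weight ds e with indexOf e (signedSequence ds)
... | just k = sign k
... | nothing = 1ℤ

entryIn : List Dir → Vertex → Vertex → List Edge → ℤ
entryIn ds u v [] = 0ℤ
entryIn ds u v (e ∷ es) with joins? e u v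
... | yes _ = weight ds e
... | no _ = entryIn ds u v es

Bentry : List Dir → Vertex → Vertex → ℤ
Bentry ds u v = entryIn ds u v (edges ds)

whiteVertices : List Dir → (Vertex → Bool) → List Vertex
whiteVertices ds col = filter (λ v → col v BoolP.≟ false) (vertices ds)

sumℤ : List ℤ → ℤ
sumℤ = foldr _+ℤ_ 0ℤ

BBᵀ : List Dir → (Vertex → Bool) → Vertex → Vertex → ℤ
BBᵀ ds col b b' = sumℤ (map (λ w → Bentry ds b w *ℤ Bentry ds b' w) (whiteVertices ds col))

-- Upper and lower boundary vertices, in order from the start edge
-- to the end edge.

upperLeft lowerRight upperRight : Vertex → Vertex
upperLeft (x , y) = x , suc y
lowerRight (x , y) = suc x , y
upperRight (x , y) = suc x , suc y

upperBoundary : List Dir → List Vertex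
upperBoundary ds = pre (firstDir ds) ++ (map upperLeft (tiles ds) ++ post (lastDir ds))
  where
  pre : Maybe Dir → List Vertex
  pre (just U) = (0 , 0) ∷ []
  pre _ = []
  post : Maybe Dir → List Vertex
  post (just U) = []
  post _ = upperRight (lastTile ds) ∷ []

lowerBoundary : List Dir → List Vertex
lowerBoundary ds = pre (firstDir ds) ++ (map lowerRight (tiles ds) ++ post (lastDir ds))
  where
  pre : Maybe Dir → List Vertex
  pre (just U) = []
  pre _ = (0 , 0) ∷ []
  post : Maybe Dir → List Vertex
  post (just U) = upperRight (lastTile ds) ∷ []
  post _ = []

blackOf : (Vertex → Bool) → List Vertex → List Vertex
blackOf col = filter (λ v → col v BoolP.≟ true)

upperBlack lowerBlack : List Dir → (Vertex → Bool) → List Vertex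
upperBlack ds col = blackOf col (upperBoundary ds)
lowerBlack ds col = blackOf col (lowerBoundary ds)

ValidBlackOrdering : List Dir → (Vertex → Bool) → Set
ValidBlackOrdering ds col =
    All (_∈ vertices ds) (upperBlack ds col ++ lowerBlack ds col)
  × Unique (upperBlack ds col ++ lowerBlack ds col)
  × (∀ v → v ∈ vertices ds → col v ≡ true → v ∈ upperBlack ds col ++ lowerBlack ds col)

orderedBlack : (ds : List Dir) (col : Vertex → Bool)
             → Fin (length (upperBlack ds col) + length (lowerBlack ds col)) → Vertex
orderedBlack ds col i with splitAt (length (upperBlack ds col)) i
... | inj₁ j = lookup (upperBlack ds col) j
... | inj₂ j = lookup (lowerBlack ds col) j

Matrix : ℕ → Set
Matrix n = Fin n → Fin n → ℤ

blockDiag : ∀ {p q} → Matrix p → Matrix q → Matrix (p + q)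
blockDiag {p} M₁ M₂ i j with splitAt p i | splitAt p j
... | inj₁ i' | inj₁ j' = M₁ i' j'
... | inj₂ i' | inj₂ j' = M₂ i' j'
... | _       | _       = 0ℤ

TridiagonalOnes : ∀ {n} → Matrix n → Set
TridiagonalOnes M = ∀ i j →
    (suc (toℕ i) ≡ toℕ j → M i j ≡ 1ℤ × M j i ≡ 1ℤ)
  × (suc (toℕ i) < toℕ j → M i j ≡ 0ℤ × M j i ≡ 0ℤ)

BBᵀordered : (ds : List Dir) (col : Vertex → Bool)
           → Matrix (length (upperBlack ds col) + length (lowerBlack ds col))
BBᵀordered ds col i j = BBᵀ ds col (orderedBlack ds col i) (orderedBlack ds col j)

module Submission where

-- Give the vertex (x , y) the level x + y. Each boundary meets every level in at most one vertex, consecutive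
-- ones joined by an edge of weight 1, and the j-th edge of the signed sequence lies on level j. As the colouring
-- is proper, the black vertices of a boundary sit on every second level, and (B Bᵀ)(b , b') vanishes unless b
-- and b' share a neighbour, i.e. unless their levels differ by 0 or 2. Two black vertices two levels apart on
-- one boundary are the ends of a straight stretch: a bend in between would be a turn adjacent to the first of
-- them, and turns are black. So they share exactly one neighbour, through two edges of weight 1, and the entry
-- is 1. Nearby black vertices on different boundaries are either too far apart in the plane or opposite
-- corners of one tile; the edge through which the snake enters that tile has a sign s, the one through which
-- it leaves has sign -s and the other two sides weight 1, so the two paths between opposite corners
-- contribute s·1 + 1·(-s) or 1·1 + s·(-s), which is 0 either way.

open import Defs
open import Data.Nat using (ℕ; zero; suc; _+_; _*_; _∸_; _≤_; _<_; z≤n; s≤s)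
import Data.Nat.Properties as ℕP
open import Data.Bool using (Bool; true; false; not)
import Data.Bool.Properties as BoolP
open import Data.Integer using (ℤ; +_; -_; 0ℤ; 1ℤ; -1ℤ) renaming (_+_ to _+ℤ_; _*_ to _*ℤ_; _≟_ to _≟ℤ_)
import Data.Integer.Properties as ℤP
open import Data.List using (List; []; _∷_; _++_; map; filter; length; lookup; concatMap)
import Data.List.Properties as ListP
open import Data.List.Membership.Propositional using (_∈_; _∉_; find; lose)
open import Data.List.Membership.Propositional.Properties
open import Data.List.Relation.Unary.Any using (here; there)
import Data.List.Relation.Unary.Any as Any
open import Data.List.Relation.Unary.All using (All)
import Data.List.Relation.Unary.All as All
import Data.List.Relation.Unary.All.Properties as AllP
open import Data.List.Relation.Unary.AllPairs using (AllPairs; []; _∷_)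
open import Data.List.Relation.Unary.Unique.Propositional using (Unique)
import Data.List.Relation.Unary.Unique.Propositional.Properties as UniqueP
import Data.List.Relation.Unary.Unique.DecPropositional.Properties _≟V_ as UniqueDecP
open import Data.Maybe using (just; nothing; fromMaybe)
open import Data.Fin using (Fin; toℕ; splitAt) renaming (zero to fzero; suc to fsuc)
open import Data.Product using (Σ; Σ-syntax; _×_; _,_; proj₁; proj₂)
open import Data.Sum using (_⊎_; inj₁; inj₂; [_,_])
open import Data.Empty using (⊥; ⊥-elim)
open import Relation.Binary.PropositionalEquality using (_≡_; _≢_; refl; sym; trans; cong; cong₂; subst; subst₂; module ≡-Reasoning)
open import Relation.Nullary using (yes; no; ¬_)
open import Relation.Binary.Definitions using (DecidableEquality)
open import Relation.Unary using (Pred; Decidable)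
open import Function using (_∘_)
open import Algebra.Properties.CommutativeSemigroup ℤP.+-commutativeSemigroup using (interchange)

level : Vertex → ℕ
level (x , y) = x + y

step : Dir → Vertex → Vertex
step R (x , y) = suc x , y
step U (x , y) = x , suc y

level-step : ∀ d p → level (step d p) ≡ suc (level p)
level-step R (x , y) = refl
level-step U (x , y) = ℕP.+-suc x y

_≟Dir_ : DecidableEquality Dir
R ≟Dir R = yes refl
U ≟Dir U = yes refl
R ≟Dir U = no λ ()
U ≟Dir R = no λ ()

R≢U : R ≢ U
R≢U ()

flip : Dir → Dir
flip R = U
flip U = R

≢⇒flip : ∀ {d d'} → d' ≢ d → d' ≡ flip d
≢⇒flip {R} {R} ≢ = ⊥-elim (≢ refl)
≢⇒flip {U} {U} ≢ = ⊥-elim (≢ refl)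
≢⇒flip {R} {U} _ = refl
≢⇒flip {U} {R} _ = refl

step-comm : ∀ d d' p → step d (step d' p) ≡ step d' (step d p)
step-comm R R p = refl
step-comm R U p = refl
step-comm U R p = refl
step-comm U U p = refl

step-flip-step : ∀ d p → step d (step (flip d) p) ≡ upperRight p
step-flip-step R p = refl
step-flip-step U p = refl

step-step-flip : ∀ d p → step (flip d) (step d p) ≡ upperRight p
step-step-flip R p = refl
step-step-flip U p = refl

level-upperLeft : ∀ p → level (upperLeft p) ≡ suc (level p)
level-upperLeft (x , y) = ℕP.+-suc x y

level-lowerRight : ∀ p → level (lowerRight p) ≡ suc (level p)
level-lowerRight (x , y) = refl

level-upperRight : ∀ p → level (upperRight p) ≡ suc (suc (level p))
level-upperRight (x , y) = cong suc (ℕP.+-suc x y)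

infix 4 _⟷_

data _⟷_ : Vertex → Vertex → Set where
  east  : ∀ {x y} → (x , y) ⟷ (suc x , y)
  north : ∀ {x y} → (x , y) ⟷ (x , suc y)
  west  : ∀ {x y} → (suc x , y) ⟷ (x , y)
  south : ∀ {x y} → (x , suc y) ⟷ (x , y)

⟷-level : ∀ {u w} → u ⟷ w → level w ≡ suc (level u) ⊎ level u ≡ suc (level w)
⟷-level (east {x} {y}) = inj₁ refl
⟷-level (north {x} {y}) = inj₁ (ℕP.+-suc x y)
⟷-level (west {x} {y}) = inj₂ refl
⟷-level (south {x} {y}) = inj₂ (ℕP.+-suc x y)

joins⇒⟷ : ∀ {e u v} → Joins e u v → u ⟷ v
joins⇒⟷ {hor x y} (inj₁ refl) = east
joins⇒⟷ {hor x y} (inj₂ refl) = west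
joins⇒⟷ {ver x y} (inj₁ refl) = north
joins⇒⟷ {ver x y} (inj₂ refl) = south

joins-sym : ∀ {e u v} → Joins e u v → Joins e v u
joins-sym (inj₁ p) = inj₂ p
joins-sym (inj₂ p) = inj₁ p

joins-unique : ∀ {e f u v} → Joins e u v → Joins f u v → e ≡ f
joins-unique {hor x y} {hor _ _} (inj₁ refl) (inj₁ refl) = refl
joins-unique {hor x y} {hor _ _} (inj₂ refl) (inj₂ refl) = refl
joins-unique {ver x y} {ver _ _} (inj₁ refl) (inj₁ refl) = refl
joins-unique {ver x y} {ver _ _} (inj₂ refl) (inj₂ refl) = refl
joins-unique {hor x y} {hor _ _} (inj₁ refl) (inj₂ ())
joins-unique {hor x y} {hor _ _} (inj₂ refl) (inj₁ ())
joins-unique {hor x y} {ver _ _} (inj₁ refl) (inj₁ ())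
joins-unique {hor x y} {ver _ _} (inj₁ refl) (inj₂ ())
joins-unique {hor x y} {ver _ _} (inj₂ refl) (inj₁ ())
joins-unique {hor x y} {ver _ _} (inj₂ refl) (inj₂ ())
joins-unique {ver x y} {ver _ _} (inj₁ refl) (inj₂ ())
joins-unique {ver x y} {ver _ _} (inj₂ refl) (inj₁ ())
joins-unique {ver x y} {hor _ _} (inj₁ refl) (inj₁ ())
joins-unique {ver x y} {hor _ _} (inj₁ refl) (inj₂ ())
joins-unique {ver x y} {hor _ _} (inj₂ refl) (inj₁ ())
joins-unique {ver x y} {hor _ _} (inj₂ refl) (inj₂ ())

common-⟷-diagonal : ∀ {x y w} → (x , y) ⟷ w → (suc x , suc y) ⟷ w → w ≡ (suc x , y) ⊎ w ≡ (x , suc y)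
common-⟷-diagonal east south = inj₁ refl
common-⟷-diagonal north west = inj₂ refl

common-⟷-antidiagonal : ∀ {x y w} → (x , suc y) ⟷ w → (suc x , y) ⟷ w → w ≡ (x , y) ⊎ w ≡ (suc x , suc y)
common-⟷-antidiagonal east north = inj₂ refl
common-⟷-antidiagonal south west = inj₁ refl

common-⟷-horizontal : ∀ {x y w} → (x , y) ⟷ w → (suc (suc x) , y) ⟷ w → w ≡ (suc x , y)
common-⟷-horizontal east west = refl

common-⟷-vertical : ∀ {x y w} → (x , y) ⟷ w → (x , suc (suc y)) ⟷ w → w ≡ (x , suc y)
common-⟷-vertical north south = refl

no-common-⟷-far-east : ∀ {x y w} → (x , suc y) ⟷ w → (suc (suc (suc x)) , y) ⟷ w → ⊥
no-common-⟷-far-east east ()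
no-common-⟷-far-east north ()
no-common-⟷-far-east west ()
no-common-⟷-far-east south ()

no-common-⟷-far-north : ∀ {x y w} → (suc x , y) ⟷ w → (x , suc (suc (suc y))) ⟷ w → ⊥
no-common-⟷-far-north east ()
no-common-⟷-far-north north ()
no-common-⟷-far-north west ()
no-common-⟷-far-north south ()

no-common-far : ∀ d p {w} → step d p ⟷ w → step (flip d) (step (flip d) (step (flip d) p)) ⟷ w → ⊥
no-common-far R (x , y) = no-common-⟷-far-north
no-common-far U (x , y) = no-common-⟷-far-east

common-⟷-straight : ∀ d p {w} → p ⟷ w → step d (step d p) ⟷ w → w ≡ step d p
common-⟷-straight R (x , y) = common-⟷-horizontal
common-⟷-straight U (x , y) = common-⟷-vertical

interval : ℕ → ℕ → List ℕ
interval a zero = []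
interval a (suc k) = a ∷ interval (suc a) k

map-interval-suc : ∀ {A : Set} (f : ℕ → A) a k → map f (interval (suc a) k) ≡ map (λ j → f (suc j)) (interval a k)
map-interval-suc f a zero = refl
map-interval-suc f a (suc k) = cong (f (suc a) ∷_) (map-interval-suc f (suc a) k)

interval-∷ʳ : ∀ a k → interval a (suc k) ≡ interval a k ++ (a + k ∷ [])
interval-∷ʳ a zero = cong (_∷ []) (sym (ℕP.+-identityʳ a))
interval-∷ʳ a (suc k) = cong (a ∷_) (trans (interval-∷ʳ (suc a) k) (cong (λ z → interval (suc a) k ++ (z ∷ [])) (sym (ℕP.+-suc a k))))

head<end : ∀ a k → a < a + suc k
head<end a k = subst (a <_) (sym (ℕP.+-suc a k)) (s≤s (ℕP.m≤m+n a k))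

∈-interval⁻ : ∀ {a k j} → j ∈ interval a k → a ≤ j × j < a + k
∈-interval⁻ {a} {suc k} (here refl) = ℕP.≤-refl , head<end a k
∈-interval⁻ {a} {suc k} {j} (there m) with ∈-interval⁻ {suc a} {k} m
... | a<j , j<end = ℕP.<⇒≤ a<j , subst (j <_) (sym (ℕP.+-suc a k)) j<end

∈-interval⁺ : ∀ {a k j} → a ≤ j → j < a + k → j ∈ interval a k
∈-interval⁺ {a} {zero} {j} a≤j j<a = ⊥-elim (ℕP.<-irrefl refl (ℕP.<-≤-trans j<a (subst (_≤ j) (sym (ℕP.+-identityʳ a)) a≤j)))
∈-interval⁺ {a} {suc k} {j} a≤j j<end with a ℕP.≟ j
... | yes refl = here refl
... | no a≢j = there (∈-interval⁺ (ℕP.≤∧≢⇒< a≤j a≢j) (subst (j <_) (ℕP.+-suc a k) j<end))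

map-cong-interval : ∀ {A : Set} (f g : ℕ → A) a k → (∀ j → a ≤ j → j < a + k → f j ≡ g j)
                  → map f (interval a k) ≡ map g (interval a k)
map-cong-interval f g a zero f≗g = refl
map-cong-interval f g a (suc k) f≗g = cong₂ _∷_ (f≗g a ℕP.≤-refl (head<end a k))
  (map-cong-interval f g (suc a) k (λ j a<j j<end → f≗g j (ℕP.<⇒≤ a<j) (subst (j <_) (sym (ℕP.+-suc a k)) j<end)))

interval-distinct : ∀ a k → AllPairs _≢_ (interval a k)
interval-distinct a zero = []
interval-distinct a (suc k) = All.tabulate (λ m a≡j → ℕP.<-irrefl a≡j (proj₁ (∈-interval⁻ m))) ∷ interval-distinct (suc a) k

-- Beyond the last index the final direction is repeated (and R is used when there are none).
dir : List Dir → ℕ → Dir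
dir [] _ = R
dir (d ∷ []) _ = d
dir (d ∷ e ∷ ds) zero = d
dir (d ∷ e ∷ ds) (suc k) = dir (e ∷ ds) k

dir-beyond : ∀ ds k → length ds ≤ suc k → dir ds (suc k) ≡ dir ds k
dir-beyond [] k _ = refl
dir-beyond (d ∷ []) k _ = refl
dir-beyond (d ∷ e ∷ ds) zero (s≤s ())
dir-beyond (d ∷ e ∷ ds) (suc k) (s≤s p) = dir-beyond (e ∷ ds) k p

dir-∷ : ∀ d ds k → k < length ds → dir (d ∷ ds) (suc k) ≡ dir ds k
dir-∷ d (e ∷ ds) k _ = refl

dir-head : ∀ d ds → dir (d ∷ ds) 0 ≡ d
dir-head d [] = refl
dir-head d (e ∷ ds) = refl

dir-first : ∀ ds → dir ds 0 ≡ fromMaybe R (firstDir ds)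
dir-first [] = refl
dir-first (d ∷ ds) = dir-head d ds

dir-last : ∀ ds → dir ds (length ds) ≡ fromMaybe R (lastDir ds)
dir-last [] = refl
dir-last (d ∷ []) = refl
dir-last (d ∷ e ∷ ds) = dir-last (e ∷ ds)

dir-change⇒inner : ∀ ds k → dir ds k ≢ dir ds (suc k) → suc k < length ds
dir-change⇒inner ds k ≢ with ℕP.≤-<-connex (length ds) (suc k)
... | inj₁ n≤k = ⊥-elim (≢ (sym (dir-beyond ds k n≤k)))
... | inj₂ k<n = k<n

tileFrom : Vertex → List Dir → ℕ → Vertex
tileFrom p [] k = p
tileFrom p (d ∷ ds) zero = p
tileFrom p (d ∷ ds) (suc k) = tileFrom (step d p) ds k

-- Lower-left corner of T_{k+1}.
tile : List Dir → ℕ → Vertex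
tile ds zero = 0 , 0
tile ds (suc k) = step (dir ds k) (tile ds k)

tileFrom-zero : ∀ p ds → tileFrom p ds 0 ≡ p
tileFrom-zero p [] = refl
tileFrom-zero p (d ∷ ds) = refl

tileFrom-suc : ∀ p ds k → k < length ds → tileFrom p ds (suc k) ≡ step (dir ds k) (tileFrom p ds k)
tileFrom-suc p (d ∷ ds) zero _ = trans (tileFrom-zero (step d p) ds) (cong (λ z → step z p) (sym (dir-head d ds)))
tileFrom-suc p (d ∷ ds) (suc k) (s≤s k<n) =
  trans (tileFrom-suc (step d p) ds k k<n) (cong (λ z → step z (tileFrom (step d p) ds k)) (sym (dir-∷ d ds k k<n)))

tile≡tileFrom : ∀ ds k → k ≤ length ds → tile ds k ≡ tileFrom (0 , 0) ds k
tile≡tileFrom ds zero _ = sym (tileFrom-zero (0 , 0) ds)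
tile≡tileFrom ds (suc k) k<n = trans (cong (step (dir ds k)) (tile≡tileFrom ds k (ℕP.<⇒≤ k<n))) (sym (tileFrom-suc (0 , 0) ds k k<n))

tilesFrom-∷ : ∀ p d ds → tilesFrom p (d ∷ ds) ≡ p ∷ tilesFrom (step d p) ds
tilesFrom-∷ (x , y) R ds = refl
tilesFrom-∷ (x , y) U ds = refl

tilesFrom≡map : ∀ p ds → tilesFrom p ds ≡ map (tileFrom p ds) (interval 0 (suc (length ds)))
tilesFrom≡map p [] = refl
tilesFrom≡map p (d ∷ ds) = trans (tilesFrom-∷ p d ds)
  (cong (p ∷_) (trans (tilesFrom≡map (step d p) ds) (sym (map-interval-suc (tileFrom p (d ∷ ds)) 0 (suc (length ds))))))

tiles≡map : ∀ ds → tiles ds ≡ map (tile ds) (interval 0 (suc (length ds)))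
tiles≡map ds = trans (tilesFrom≡map (0 , 0) ds)
  (map-cong-interval _ _ 0 (suc (length ds)) (λ j _ j<n → sym (tile≡tileFrom ds j (ℕP.≤-pred j<n))))

lastTileFrom-∷ : ∀ p d ds → lastTileFrom p (d ∷ ds) ≡ lastTileFrom (step d p) ds
lastTileFrom-∷ (x , y) R ds = refl
lastTileFrom-∷ (x , y) U ds = refl

lastTileFrom≡tileFrom : ∀ p ds → lastTileFrom p ds ≡ tileFrom p ds (length ds)
lastTileFrom≡tileFrom p [] = refl
lastTileFrom≡tileFrom p (d ∷ ds) = trans (lastTileFrom-∷ p d ds) (lastTileFrom≡tileFrom (step d p) ds)

lastTile≡tile : ∀ ds → lastTile ds ≡ tile ds (length ds)
lastTile≡tile ds = trans (lastTileFrom≡tileFrom (0 , 0) ds) (sym (tile≡tileFrom ds (length ds) ℕP.≤-refl))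

level-tile : ∀ ds k → level (tile ds k) ≡ k
level-tile ds zero = refl
level-tile ds (suc k) = trans (level-step (dir ds k) (tile ds k)) (cong suc (level-tile ds k))

tile-suc : ∀ ds k {d} → dir ds k ≡ d → tile ds (suc k) ≡ step d (tile ds k)
tile-suc ds k e = cong (λ d → step d (tile ds k)) e

tile∈tiles : ∀ ds k → k ≤ length ds → tile ds k ∈ tiles ds
tile∈tiles ds k k≤n = subst (tile ds k ∈_) (sym (tiles≡map ds)) (∈-map⁺ (tile ds) (∈-interval⁺ z≤n (s≤s k≤n)))

∈tiles⇒tile : ∀ ds t → t ∈ tiles ds → Σ[ k ∈ ℕ ] k ≤ length ds × t ≡ tile ds k
∈tiles⇒tile ds t m with ∈-map⁻ (tile ds) (subst (t ∈_) (tiles≡map ds) m)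
... | k , k∈ , t≡ = k , ℕP.≤-pred (proj₂ (∈-interval⁻ k∈)) , t≡

exitEdge entryEdge : Vertex → Dir → Edge
exitEdge (x , y) R = ver (suc x) y
exitEdge (x , y) U = hor x (suc y)
entryEdge (x , y) R = ver x y
entryEdge (x , y) U = hor x y

exitEdge≡entryEdge : ∀ p d → exitEdge p d ≡ entryEdge (step d p) d
exitEdge≡entryEdge (x , y) R = refl
exitEdge≡entryEdge (x , y) U = refl

entryEdge-joins : ∀ p d → Joins (entryEdge p (flip d)) p (step d p)
entryEdge-joins (x , y) R = inj₁ refl
entryEdge-joins (x , y) U = inj₁ refl

exitEdge-joins-upperRight : ∀ p d → Joins (exitEdge p d) (step d p) (upperRight p)
exitEdge-joins-upperRight (x , y) R = inj₁ refl
exitEdge-joins-upperRight (x , y) U = inj₁ refl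

signedEdge : List Dir → ℕ → Edge
signedEdge ds zero = entryEdge (0 , 0) (dir ds 0)
signedEdge ds (suc k) = exitEdge (tile ds k) (dir ds k)

signedEdge≡entryEdge : ∀ ds k → signedEdge ds k ≡ entryEdge (tile ds k) (dir ds (k ∸ 1))
signedEdge≡entryEdge ds zero = refl
signedEdge≡entryEdge ds (suc k) = exitEdge≡entryEdge (tile ds k) (dir ds k)

edgeLevel : Edge → ℕ
edgeLevel (hor x y) = x + y
edgeLevel (ver x y) = x + y

edgeLevel-exitEdge : ∀ p d → edgeLevel (exitEdge p d) ≡ suc (level p)
edgeLevel-exitEdge (x , y) R = refl
edgeLevel-exitEdge (x , y) U = ℕP.+-suc x y

edgeLevel-signedEdge : ∀ ds j → edgeLevel (signedEdge ds j) ≡ j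
edgeLevel-signedEdge ds zero with dir ds 0
... | R = refl
... | U = refl
edgeLevel-signedEdge ds (suc k) = trans (edgeLevel-exitEdge (tile ds k) (dir ds k)) (cong suc (level-tile ds k))

sharedEdgesFrom-∷ : ∀ p d ds → sharedEdgesFrom p (d ∷ ds) ≡ exitEdge p d ∷ sharedEdgesFrom (step d p) ds
sharedEdgesFrom-∷ (x , y) R ds = refl
sharedEdgesFrom-∷ (x , y) U ds = refl

sharedEdgesFrom≡map : ∀ p ds → sharedEdgesFrom p ds ≡ map (λ k → exitEdge (tileFrom p ds k) (dir ds k)) (interval 0 (length ds))
sharedEdgesFrom≡map p [] = refl
sharedEdgesFrom≡map p (d ∷ ds) = trans (sharedEdgesFrom-∷ p d ds)
  (cong₂ _∷_ (cong (exitEdge p) (sym (dir-head d ds)))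
    (trans (sharedEdgesFrom≡map (step d p) ds)
      (trans (map-cong-interval _ _ 0 (length ds) (λ j _ j<n → cong (exitEdge (tileFrom (step d p) ds j)) (sym (dir-∷ d ds j j<n))))
        (sym (map-interval-suc (λ k → exitEdge (tileFrom p (d ∷ ds) k) (dir (d ∷ ds) k)) 0 (length ds))))))

sharedEdges≡map : ∀ ds → sharedEdgesFrom (0 , 0) ds ≡ map (λ k → signedEdge ds (suc k)) (interval 0 (length ds))
sharedEdges≡map ds = trans (sharedEdgesFrom≡map (0 , 0) ds)
  (map-cong-interval _ _ 0 (length ds) (λ j _ j<n → cong (λ t → exitEdge t (dir ds j)) (sym (tile≡tileFrom ds j (ℕP.<⇒≤ j<n)))))

startEdge≡signedEdge : ∀ ds → startEdge ds ≡ signedEdge ds 0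
startEdge≡signedEdge [] = refl
startEdge≡signedEdge (R ∷ []) = refl
startEdge≡signedEdge (R ∷ e ∷ ds) = refl
startEdge≡signedEdge (U ∷ []) = refl
startEdge≡signedEdge (U ∷ e ∷ ds) = refl

endEdge≡exitEdge : ∀ ds → endEdge ds ≡ exitEdge (lastTile ds) (fromMaybe R (lastDir ds))
endEdge≡exitEdge ds with lastDir ds | lastTile ds
... | just R | (x , y) = refl
... | just U | (x , y) = refl
... | nothing | (x , y) = refl

endEdge≡signedEdge : ∀ ds → endEdge ds ≡ signedEdge ds (suc (length ds))
endEdge≡signedEdge ds = trans (endEdge≡exitEdge ds) (cong₂ exitEdge (lastTile≡tile ds) (sym (dir-last ds)))

signedSequence≡map : ∀ ds → signedSequence ds ≡ map (signedEdge ds) (interval 0 (suc (suc (length ds))))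
signedSequence≡map ds = cong₂ _∷_ (startEdge≡signedEdge ds) (begin
    sharedEdgesFrom (0 , 0) ds ++ (endEdge ds ∷ [])
  ≡⟨ cong₂ _++_ (sharedEdges≡map ds) (cong (_∷ []) (endEdge≡signedEdge ds)) ⟩
    map (λ k → signedEdge ds (suc k)) (interval 0 (length ds)) ++ map (λ k → signedEdge ds (suc k)) (length ds ∷ [])
  ≡⟨ sym (ListP.map-++ _ (interval 0 (length ds)) (length ds ∷ [])) ⟩
    map (λ k → signedEdge ds (suc k)) (interval 0 (length ds) ++ (length ds ∷ []))
  ≡⟨ cong (map (λ k → signedEdge ds (suc k))) (sym (interval-∷ʳ 0 (length ds))) ⟩
    map (λ k → signedEdge ds (suc k)) (interval 0 (suc (length ds)))
  ≡⟨ sym (map-interval-suc (signedEdge ds) 0 (suc (length ds))) ⟩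
    map (signedEdge ds) (interval 1 (suc (length ds)))
  ∎)
  where open ≡-Reasoning

-- Entries on distinct levels are distinct, so the first match is the intended one.
indexOf-levelled : ∀ (g : ℕ → Edge) → (∀ j → edgeLevel (g j) ≡ j)
                 → ∀ a k j → a ≤ j → j < a + k → indexOf (g j) (map g (interval a k)) ≡ just (j ∸ a)
indexOf-levelled g level-g a zero j a≤j j<a = ⊥-elim (ℕP.<-irrefl refl (ℕP.<-≤-trans j<a (subst (_≤ j) (sym (ℕP.+-identityʳ a)) a≤j)))
indexOf-levelled g level-g a (suc k) j a≤j j<end with g j ≟E g a
... | yes gj≡ga rewrite trans (sym (level-g j)) (trans (cong edgeLevel gj≡ga) (level-g a)) = cong just (sym (ℕP.n∸n≡0 a))
... | no gj≢ga with a ℕP.≟ j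
...   | yes refl = ⊥-elim (gj≢ga refl)
...   | no a≢j rewrite indexOf-levelled g level-g (suc a) k j (ℕP.≤∧≢⇒< a≤j a≢j) (subst (j <_) (ℕP.+-suc a k) j<end) =
          cong just (sym (ℕP.+-∸-assoc 1 (ℕP.≤∧≢⇒< a≤j a≢j)))

indexOf-absent : ∀ (g : ℕ → Edge) e a k → (∀ j → a ≤ j → j < a + k → e ≢ g j) → indexOf e (map g (interval a k)) ≡ nothing
indexOf-absent g e a zero e∉ = refl
indexOf-absent g e a (suc k) e∉ with e ≟E g a
... | yes e≡ga = ⊥-elim (e∉ a ℕP.≤-refl (head<end a k) e≡ga)
... | no _ rewrite indexOf-absent g e (suc a) k (λ j a<j j<end → e∉ j (ℕP.<⇒≤ a<j) (subst (j <_) (sym (ℕP.+-suc a k)) j<end)) = refl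

weight-on-sequence : ∀ ds k {e} → k ≤ suc (length ds) → signedEdge ds k ≡ e → weight ds e ≡ sign k
weight-on-sequence ds k k≤ refl = present⇒weight (trans (cong (indexOf (signedEdge ds k)) (signedSequence≡map ds))
                                                        (indexOf-levelled (signedEdge ds) (edgeLevel-signedEdge ds) 0 _ k z≤n (s≤s k≤)))
  where
  present⇒weight : indexOf (signedEdge ds k) (signedSequence ds) ≡ just k → weight ds (signedEdge ds k) ≡ sign k
  present⇒weight eq with indexOf (signedEdge ds k) (signedSequence ds)
  present⇒weight refl | .(just k) = refl

weight-off-sequence : ∀ ds k {e} → edgeLevel e ≡ k → e ≢ signedEdge ds k → weight ds e ≡ 1ℤ
weight-off-sequence ds _ {e} refl e≢ = absent⇒weight (trans (cong (indexOf e) (signedSequence≡map ds)) (indexOf-absent (signedEdge ds) e 0 _ e∉))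
  where
  absent⇒weight : indexOf e (signedSequence ds) ≡ nothing → weight ds e ≡ 1ℤ
  absent⇒weight eq with indexOf e (signedSequence ds)
  absent⇒weight refl | .nothing = refl
  e∉ : ∀ j → 0 ≤ j → j < suc (suc (length ds)) → e ≢ signedEdge ds j
  e∉ j _ _ e≡ = e≢ (subst (λ z → e ≡ signedEdge ds z) (sym (trans (cong edgeLevel e≡) (edgeLevel-signedEdge ds j))) e≡)

entryIn-joins : ∀ ds u v e es → e ∈ es → Joins e u v → entryIn ds u v es ≡ weight ds e
entryIn-joins ds u v e (f ∷ fs) e∈ e-uv with joins? f u v
... | yes f-uv = cong (weight ds) (joins-unique f-uv e-uv)
entryIn-joins ds u v e (f ∷ fs) (here refl) e-uv | no ¬f-uv = ⊥-elim (¬f-uv e-uv)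
entryIn-joins ds u v e (f ∷ fs) (there e∈) e-uv | no _ = entryIn-joins ds u v e fs e∈ e-uv

Bentry-joins : ∀ ds u v e → e ∈ edges ds → Joins e u v → Bentry ds u v ≡ weight ds e
Bentry-joins ds u v e = entryIn-joins ds u v e (edges ds)

entryIn≢0⇒joins : ∀ ds u v es → entryIn ds u v es ≢ 0ℤ → Σ[ e ∈ Edge ] e ∈ es × Joins e u v
entryIn≢0⇒joins ds u v [] ≢0 = ⊥-elim (≢0 refl)
entryIn≢0⇒joins ds u v (f ∷ fs) ≢0 with joins? f u v
... | yes f-uv = f , here refl , f-uv
... | no _ with entryIn≢0⇒joins ds u v fs ≢0
...   | e , e∈ , e-uv = e , there e∈ , e-uv

Bentry≢0⇒joins : ∀ ds u v → Bentry ds u v ≢ 0ℤ → Σ[ e ∈ Edge ] e ∈ edges ds × Joins e u v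
Bentry≢0⇒joins ds u v = entryIn≢0⇒joins ds u v (edges ds)

tileEdge∈edges : ∀ ds k → k ≤ length ds → ∀ {p} → tile ds k ≡ p → ∀ e → e ∈ tileEdges p → e ∈ edges ds
tileEdge∈edges ds k k≤n tile≡p e e∈ = ∈-concatMap⁺ tileEdges
  (Any.map (λ { refl → e∈ }) (subst (_∈ tiles ds) tile≡p (tile∈tiles ds k k≤n)))

endpoint∈tileCorners : ∀ {t e u w} → e ∈ tileEdges t → Joins e u w → w ∈ tileCorners t
endpoint∈tileCorners {x , y} (here refl) (inj₁ refl) = there (here refl)
endpoint∈tileCorners {x , y} (here refl) (inj₂ refl) = here refl
endpoint∈tileCorners {x , y} (there (here refl)) (inj₁ refl) = there (there (there (here refl)))
endpoint∈tileCorners {x , y} (there (here refl)) (inj₂ refl) = there (there (here refl))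
endpoint∈tileCorners {x , y} (there (there (here refl))) (inj₁ refl) = there (there (here refl))
endpoint∈tileCorners {x , y} (there (there (here refl))) (inj₂ refl) = here refl
endpoint∈tileCorners {x , y} (there (there (there (here refl)))) (inj₁ refl) = there (there (there (here refl)))
endpoint∈tileCorners {x , y} (there (there (there (here refl)))) (inj₂ refl) = there (here refl)

corner∈vertices : ∀ ds t v → t ∈ tiles ds → v ∈ tileCorners t → v ∈ vertices ds
corner∈vertices ds t v t∈ v∈ = ∈-deduplicate⁺ _≟V_ (∈-concatMap⁺ tileCorners (Any.map (λ { refl → v∈ }) t∈))

endpoint∈vertices : ∀ ds e u w → e ∈ edges ds → Joins e u w → w ∈ vertices ds
endpoint∈vertices ds e u w e∈ e-uw with find (∈-concatMap⁻ tileEdges {xs = tiles ds} e∈)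
... | t , t∈ , e∈t = corner∈vertices ds t w t∈ (endpoint∈tileCorners e∈t e-uw)

vertex⇒corner : ∀ ds v → v ∈ vertices ds → Σ[ k ∈ ℕ ] k ≤ length ds × v ∈ tileCorners (tile ds k)
vertex⇒corner ds v v∈ with find (∈-concatMap⁻ tileCorners {xs = tiles ds} (∈-deduplicate⁻ _≟V_ (concatMap tileCorners (tiles ds)) v∈))
... | t , t∈ , v∈t with ∈tiles⇒tile ds t t∈
...   | k , k≤n , refl = k , k≤n , v∈t

colours-differ : ∀ ds col → ProperColouring ds col → ∀ {e u w} → e ∈ edges ds → Joins e u w → col u ≢ col w
colours-differ ds col proper e∈ (inj₁ refl) = proper _ e∈
colours-differ ds col proper e∈ (inj₂ refl) = λ eq → proper _ e∈ (sym eq)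

Bentry≢0⇒white : ∀ ds {col} → ProperColouring ds col → ∀ {b w} → col b ≡ true → Bentry ds b w ≢ 0ℤ → w ∈ whiteVertices ds col
Bentry≢0⇒white ds {col} proper {b} {w} black ≢0 with Bentry≢0⇒joins ds b w ≢0
... | e , e∈ , e-bw = ∈-filter⁺ (λ v → col v BoolP.≟ false) (endpoint∈vertices ds e b w e∈ e-bw)
                        (BoolP.¬-not (λ w-black → colours-differ ds col proper e∈ e-bw (trans black (sym w-black))))

module _ {A : Set} where

  sumOver : List A → (A → ℤ) → ℤ
  sumOver L f = sumℤ (map f L)

  sumOver-cong : ∀ L {f g} → (∀ w → f w ≡ g w) → sumOver L f ≡ sumOver L g
  sumOver-cong L f≗g = cong sumℤ (ListP.map-cong f≗g L)

  sumOver-zero : ∀ L f → (∀ w → w ∈ L → f w ≡ 0ℤ) → sumOver L f ≡ 0ℤ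
  sumOver-zero [] f _ = refl
  sumOver-zero (a ∷ L) f f≡0 = cong₂ _+ℤ_ (f≡0 a (here refl)) (sumOver-zero L f (λ w w∈ → f≡0 w (there w∈)))

  sumOver-+ : ∀ L f g → sumOver L (λ w → f w +ℤ g w) ≡ sumOver L f +ℤ sumOver L g
  sumOver-+ [] f g = refl
  sumOver-+ (a ∷ L) f g = trans (cong ((f a +ℤ g a) +ℤ_) (sumOver-+ L f g)) (interchange (f a) (g a) _ _)

  indicator : ∀ {ℓ} {P : Pred A ℓ} → Decidable P → A → ℤ
  indicator P? w with P? w
  ... | yes _ = 1ℤ
  ... | no _ = 0ℤ

  length-filter≡sumOver : ∀ {ℓ} {P : Pred A ℓ} (P? : Decidable P) L → + length (filter P? L) ≡ sumOver L (indicator P?)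
  length-filter≡sumOver P? [] = refl
  length-filter≡sumOver P? (a ∷ L) with P? a
  ... | yes _ = cong (1ℤ +ℤ_) (length-filter≡sumOver P? L)
  ... | no _ = trans (length-filter≡sumOver P? L) (sym (ℤP.+-identityˡ _))

module PointMass {A : Set} (_≟_ : DecidableEquality A) where

  pointMass : A → ℤ → A → ℤ
  pointMass c v w with w ≟ c
  ... | yes _ = v
  ... | no _ = 0ℤ

  pointMass-at : ∀ c v → pointMass c v c ≡ v
  pointMass-at c v with c ≟ c
  ... | yes _ = refl
  ... | no c≢c = ⊥-elim (c≢c refl)

  pointMass-off : ∀ c v w → w ≢ c → pointMass c v w ≡ 0ℤ
  pointMass-off c v w w≢c with w ≟ c
  ... | yes w≡c = ⊥-elim (w≢c w≡c)
  ... | no _ = refl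

  sumOver-pointMass : ∀ L c v → Unique L → (c ∉ L → v ≡ 0ℤ) → sumOver L (pointMass c v) ≡ v
  sumOver-pointMass [] c v _ c∉⇒0 = sym (c∉⇒0 (λ ()))
  sumOver-pointMass (a ∷ L) c v (a∉L ∷ uniq) c∉⇒0 with a ≟ c
  ... | yes refl = trans (cong (v +ℤ_) (sumOver-zero L (pointMass a v) (λ w w∈ → pointMass-off a v w (λ { refl → All.lookup a∉L w∈ refl }))))
                         (ℤP.+-identityʳ v)
  ... | no a≢c = trans (ℤP.+-identityˡ _)
                   (sumOver-pointMass L c v uniq (λ c∉L → c∉⇒0 (λ { (here c≡a) → a≢c (sym c≡a) ; (there c∈L) → c∉L c∈L })))

  sumOver-support₁ : ∀ L f c → Unique L → (∀ w → w ≢ c → f w ≡ 0ℤ) → (c ∉ L → f c ≡ 0ℤ) → sumOver L f ≡ f c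
  sumOver-support₁ L f c uniq supp c∉⇒0 = trans (sumOver-cong L f≗) (sumOver-pointMass L c (f c) uniq c∉⇒0)
    where
    f≗ : ∀ w → f w ≡ pointMass c (f c) w
    f≗ w with w ≟ c
    ... | yes refl = refl
    ... | no w≢c = supp w w≢c

  sumOver-support₂ : ∀ L f c₁ c₂ → Unique L → c₁ ≢ c₂ → (∀ w → w ≢ c₁ → w ≢ c₂ → f w ≡ 0ℤ)
                   → (c₁ ∉ L → f c₁ ≡ 0ℤ) → (c₂ ∉ L → f c₂ ≡ 0ℤ) → sumOver L f ≡ f c₁ +ℤ f c₂
  sumOver-support₂ L f c₁ c₂ uniq c₁≢c₂ supp c₁∉⇒0 c₂∉⇒0 = begin
      sumOver L f
    ≡⟨ sumOver-cong L f≗ ⟩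
      sumOver L (λ w → pointMass c₁ (f c₁) w +ℤ pointMass c₂ (f c₂) w)
    ≡⟨ sumOver-+ L _ _ ⟩
      sumOver L (pointMass c₁ (f c₁)) +ℤ sumOver L (pointMass c₂ (f c₂))
    ≡⟨ cong₂ _+ℤ_ (sumOver-pointMass L c₁ _ uniq c₁∉⇒0) (sumOver-pointMass L c₂ _ uniq c₂∉⇒0) ⟩
      f c₁ +ℤ f c₂
    ∎
    where
    open ≡-Reasoning
    f≗ : ∀ w → f w ≡ pointMass c₁ (f c₁) w +ℤ pointMass c₂ (f c₂) w
    f≗ w with w ≟ c₁ | w ≟ c₂
    ... | yes refl | yes refl = ⊥-elim (c₁≢c₂ refl)
    ... | yes refl | no _ = sym (ℤP.+-identityʳ _)
    ... | no _ | yes refl = sym (ℤP.+-identityˡ _)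
    ... | no w≢c₁ | no w≢c₂ = supp w w≢c₁ w≢c₂

open PointMass _≟V_

BBᵀterm : List Dir → Vertex → Vertex → Vertex → ℤ
BBᵀterm ds b b' w = Bentry ds b w *ℤ Bentry ds b' w

whiteVertices-unique : ∀ ds col → Unique (whiteVertices ds col)
whiteVertices-unique ds col = UniqueDecP.filter⁺ (λ v → col v BoolP.≟ false) (UniqueDecP.deduplicate-! (concatMap tileCorners (tiles ds)))

BBᵀterm-joins : ∀ ds {b b' w e e'} → e ∈ edges ds → Joins e b w → e' ∈ edges ds → Joins e' b' w
              → BBᵀterm ds b b' w ≡ weight ds e *ℤ weight ds e'
BBᵀterm-joins ds e∈ e-bw e'∈ e'-b'w = cong₂ _*ℤ_ (Bentry-joins ds _ _ _ e∈ e-bw) (Bentry-joins ds _ _ _ e'∈ e'-b'w)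

BBᵀterm-non-white : ∀ ds {col} → ProperColouring ds col → ∀ {b} b' {w} → col b ≡ true → w ∉ whiteVertices ds col
                  → BBᵀterm ds b b' w ≡ 0ℤ
BBᵀterm-non-white ds proper {b} b' {w} black w∉ with Bentry ds b w ≟ℤ 0ℤ
... | yes ≡0 rewrite ≡0 = refl
... | no ≢0 = ⊥-elim (w∉ (Bentry≢0⇒white ds proper black ≢0))

BBᵀterm-no-common : ∀ ds b b' w → ¬ (b ⟷ w × b' ⟷ w) → BBᵀterm ds b b' w ≡ 0ℤ
BBᵀterm-no-common ds b b' w ¬common with Bentry ds b w ≟ℤ 0ℤ | Bentry ds b' w ≟ℤ 0ℤ
... | yes ≡0 | _ rewrite ≡0 = refl
... | no _ | yes ≡0 rewrite ≡0 = ℤP.*-zeroʳ (Bentry ds b w)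
... | no ≢0 | no ≢0' with Bentry≢0⇒joins ds b w ≢0 | Bentry≢0⇒joins ds b' w ≢0'
...   | _ , _ , e-bw | _ , _ , e-b'w = ⊥-elim (¬common (joins⇒⟷ e-bw , joins⇒⟷ e-b'w))

BBᵀ-sym : ∀ ds col b b' → BBᵀ ds col b b' ≡ BBᵀ ds col b' b
BBᵀ-sym ds col b b' = sumOver-cong (whiteVertices ds col) (λ w → ℤP.*-comm (Bentry ds b w) (Bentry ds b' w))

BBᵀ-no-common : ∀ ds col b b' → (∀ {w} → b ⟷ w → b' ⟷ w → ⊥) → BBᵀ ds col b b' ≡ 0ℤ
BBᵀ-no-common ds col b b' none =
  sumOver-zero (whiteVertices ds col) (BBᵀterm ds b b') (λ w _ → BBᵀterm-no-common ds b b' w (λ (b⟷w , b'⟷w) → none b⟷w b'⟷w))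

BBᵀ-one-common : ∀ ds {col} → ProperColouring ds col → ∀ {b} b' c → col b ≡ true
               → (∀ {w} → b ⟷ w → b' ⟷ w → w ≡ c) → BBᵀ ds col b b' ≡ BBᵀterm ds b b' c
BBᵀ-one-common ds {col} proper {b} b' c black only-c =
  sumOver-support₁ (whiteVertices ds col) (BBᵀterm ds b b') c (whiteVertices-unique ds col)
    (λ w w≢c → BBᵀterm-no-common ds b b' w (λ (b⟷w , b'⟷w) → w≢c (only-c b⟷w b'⟷w)))
    (BBᵀterm-non-white ds proper b' black)

BBᵀ-two-common : ∀ ds {col} → ProperColouring ds col → ∀ {b} b' c₁ c₂ → col b ≡ true → c₁ ≢ c₂
               → (∀ {w} → b ⟷ w → b' ⟷ w → w ≡ c₁ ⊎ w ≡ c₂) → BBᵀ ds col b b' ≡ BBᵀterm ds b b' c₁ +ℤ BBᵀterm ds b b' c₂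
BBᵀ-two-common ds {col} proper {b} b' c₁ c₂ black c₁≢c₂ only-c₁c₂ =
  sumOver-support₂ (whiteVertices ds col) (BBᵀterm ds b b') c₁ c₂ (whiteVertices-unique ds col) c₁≢c₂
    (λ w w≢c₁ w≢c₂ → BBᵀterm-no-common ds b b' w λ (b⟷w , b'⟷w) → [ w≢c₁ , w≢c₂ ] (only-c₁c₂ b⟷w b'⟷w))
    (BBᵀterm-non-white ds proper b' black) (BBᵀterm-non-white ds proper b' black)

BBᵀ-far-levels : ∀ ds col b b' → level b ≢ level b' → suc (suc (level b)) ≢ level b' → suc (suc (level b')) ≢ level b
               → BBᵀ ds col b b' ≡ 0ℤ
BBᵀ-far-levels ds col b b' ≢0 ≢+2 ≢-2 = BBᵀ-no-common ds col b b' common⇒near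
  where
  common⇒near : ∀ {w} → b ⟷ w → b' ⟷ w → ⊥
  common⇒near b⟷w b'⟷w with ⟷-level b⟷w | ⟷-level b'⟷w
  ... | inj₁ p | inj₁ q = ≢0 (ℕP.suc-injective (trans (sym p) q))
  ... | inj₁ p | inj₂ q = ≢+2 (trans (cong suc (sym p)) (sym q))
  ... | inj₂ p | inj₁ q = ≢-2 (trans (cong suc (sym q)) (sym p))
  ... | inj₂ p | inj₂ q = ≢0 (trans p (sym q))

module _ (ds : List Dir) (x y : ℕ)
         (west∈ : hor x (suc y) ∈ edges ds) (east∈ : hor (suc x) (suc y) ∈ edges ds)
         (south∈ : ver (suc x) y ∈ edges ds) (north∈ : ver (suc x) (suc y) ∈ edges ds) where

  private
    v W E S N : Vertex
    v = suc x , suc y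
    W = x , suc y
    E = suc (suc x) , suc y
    S = suc x , y
    N = suc x , suc (suc y)

    neighbours-indicator : ∀ u → indicator (adjacent? ds v) u
                           ≡ (pointMass W 1ℤ u +ℤ pointMass E 1ℤ u) +ℤ (pointMass S 1ℤ u +ℤ pointMass N 1ℤ u)
    neighbours-indicator u with adjacent? ds v u
    ... | yes v~u with find v~u
    ...   | _ , _ , e-vu with joins⇒⟷ e-vu
    ...     | east rewrite pointMass-off W 1ℤ E (λ ()) | pointMass-at E 1ℤ | pointMass-off S 1ℤ E (λ ()) | pointMass-off N 1ℤ E (λ ()) = refl
    ...     | north rewrite pointMass-off W 1ℤ N (λ ()) | pointMass-off E 1ℤ N (λ ()) | pointMass-off S 1ℤ N (λ ()) | pointMass-at N 1ℤ = refl
    ...     | west rewrite pointMass-at W 1ℤ | pointMass-off E 1ℤ W (λ ()) | pointMass-off S 1ℤ W (λ ()) | pointMass-off N 1ℤ W (λ ()) = refl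
    ...     | south rewrite pointMass-off W 1ℤ S (λ ()) | pointMass-off E 1ℤ S (λ ()) | pointMass-at S 1ℤ | pointMass-off N 1ℤ S (λ ()) = refl
    neighbours-indicator u | no ¬v~u
      rewrite pointMass-off W 1ℤ u (λ { refl → ¬v~u (lose west∈ (inj₂ refl)) })
            | pointMass-off E 1ℤ u (λ { refl → ¬v~u (lose east∈ (inj₁ refl)) })
            | pointMass-off S 1ℤ u (λ { refl → ¬v~u (lose south∈ (inj₂ refl)) })
            | pointMass-off N 1ℤ u (λ { refl → ¬v~u (lose north∈ (inj₁ refl)) }) = refl

    sumOver-vertices-pointMass : ∀ {e} c → e ∈ edges ds → Joins e v c → sumOver (vertices ds) (pointMass c 1ℤ) ≡ 1ℤ
    sumOver-vertices-pointMass c e∈ e-vc =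
      sumOver-pointMass (vertices ds) c 1ℤ (UniqueDecP.deduplicate-! _) (λ c∉ → ⊥-elim (c∉ (endpoint∈vertices ds _ v c e∈ e-vc)))

  crossing-degree : degree ds v ≡ 4
  crossing-degree = ℤP.+-injective (begin
      + degree ds v
    ≡⟨ length-filter≡sumOver (adjacent? ds v) (vertices ds) ⟩
      sumOver (vertices ds) (indicator (adjacent? ds v))
    ≡⟨ sumOver-cong (vertices ds) neighbours-indicator ⟩
      sumOver (vertices ds) (λ u → (pointMass W 1ℤ u +ℤ pointMass E 1ℤ u) +ℤ (pointMass S 1ℤ u +ℤ pointMass N 1ℤ u))
    ≡⟨ trans (sumOver-+ (vertices ds) _ _) (cong₂ _+ℤ_ (sumOver-+ (vertices ds) _ _) (sumOver-+ (vertices ds) _ _)) ⟩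
      (sumOver (vertices ds) (pointMass W 1ℤ) +ℤ sumOver (vertices ds) (pointMass E 1ℤ))
        +ℤ (sumOver (vertices ds) (pointMass S 1ℤ) +ℤ sumOver (vertices ds) (pointMass N 1ℤ))
    ≡⟨ cong₂ _+ℤ_ (cong₂ _+ℤ_ (sumOver-vertices-pointMass W west∈ (inj₂ refl)) (sumOver-vertices-pointMass E east∈ (inj₁ refl)))
                  (cong₂ _+ℤ_ (sumOver-vertices-pointMass S south∈ (inj₂ refl)) (sumOver-vertices-pointMass N north∈ (inj₁ refl))) ⟩
      + 4
    ∎)
    where open ≡-Reasoning

  crossing∈vertices : v ∈ vertices ds
  crossing∈vertices = endpoint∈vertices ds _ W v west∈ (inj₁ refl)

excluded≡ : ∀ ds → excluded ds ≡ (1 , 0) ∷ (0 , 0) ∷ (0 , 1)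
                                 ∷ upperLeft (lastTile ds) ∷ upperRight (lastTile ds) ∷ lowerRight (lastTile ds) ∷ []
excluded≡ ds with lastTile ds
... | (x , y) = refl

above-last : ∀ ds {m} → suc (level (tile ds (length ds))) ≤ m → suc (length ds) ≤ m
above-last ds = subst (λ l → suc l ≤ _) (level-tile ds (length ds))

level-excluded : ∀ ds v → v ∈ excluded ds → level v ≤ 1 ⊎ suc (length ds) ≤ level v
level-excluded ds v v∈ rewrite excluded≡ ds | lastTile≡tile ds with v∈
... | here refl = inj₁ ℕP.≤-refl
... | there (here refl) = inj₁ z≤n
... | there (there (here refl)) = inj₁ ℕP.≤-refl
... | there (there (there (here refl))) = inj₂ (above-last ds (ℕP.≤-reflexive (sym (level-upperLeft (tile ds (length ds))))))
... | there (there (there (there (here refl)))) = inj₂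
    (above-last ds (ℕP.≤-trans (ℕP.n≤1+n _) (ℕP.≤-reflexive (sym (level-upperRight (tile ds (length ds)))))))
... | there (there (there (there (there (here refl))))) = inj₂ (above-last ds (ℕP.≤-reflexive (sym (level-lowerRight (tile ds (length ds))))))

crossing-turn : ∀ ds x y → hor x (suc y) ∈ edges ds → hor (suc x) (suc y) ∈ edges ds
              → ver (suc x) y ∈ edges ds → ver (suc x) (suc y) ∈ edges ds
              → 2 ≤ level (suc x , suc y) → level (suc x , suc y) ≤ length ds → Turn ds (suc x , suc y)
crossing-turn ds x y west∈ east∈ south∈ north∈ 2≤ ≤n =
  crossing∈vertices ds x y west∈ east∈ south∈ north∈ , inj₂ (crossing-degree ds x y west∈ east∈ south∈ north∈) , not-excluded
  where
  not-excluded : (suc x , suc y) ∉ excluded ds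
  not-excluded v∈ with level-excluded ds _ v∈
  ... | inj₁ ≤1 = ℕP.<-irrefl refl (ℕP.<-≤-trans 2≤ ≤1)
  ... | inj₂ n< = ℕP.<-irrefl refl (ℕP.<-≤-trans n< ≤n)

mismatch : Dir → Dir → ℕ
mismatch R R = 0
mismatch U U = 0
mismatch R U = 1
mismatch U R = 1

mismatch≡0 : ∀ d d' → mismatch d d' ≡ 0 → d' ≡ d
mismatch≡0 R R _ = refl
mismatch≡0 U U _ = refl

mismatch≡1 : ∀ d d' → mismatch d d' ≡ 1 → d' ≢ d
mismatch≡1 R U _ ()
mismatch≡1 U R _ ()

-- Side U is the upper boundary and side R the lower one.
sideVertex : Dir → List Dir → ℕ → Vertex
sideVertex d ds zero = 0 , 0
sideVertex d ds (suc k) = step d (tile ds k)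

sideDir : Dir → List Dir → ℕ → Dir
sideDir d ds zero = d
sideDir d ds (suc k) = dir ds k

sideVertex-suc : ∀ d ds j → sideVertex d ds (suc j) ≡ step (sideDir d ds j) (sideVertex d ds j)
sideVertex-suc d ds zero = refl
sideVertex-suc d ds (suc k) = step-comm d (dir ds k) (tile ds k)

level-sideVertex : ∀ d ds j → level (sideVertex d ds j) ≡ j
level-sideVertex d ds zero = refl
level-sideVertex d ds (suc k) = trans (level-step d (tile ds k)) (cong suc (level-tile ds k))

-- (0 , 0) lies on side d iff T₂ is placed in direction d, and the upper right corner of T_N iff T_N is not.
sideLevels : Dir → List Dir → List ℕ
sideLevels d ds = interval (mismatch d (dir ds 0)) (suc (suc (length ds) + mismatch d (dir ds (length ds))) ∸ mismatch d (dir ds 0))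

sideLevels-distinct : ∀ d ds → AllPairs _≢_ (sideLevels d ds)
sideLevels-distinct d ds = interval-distinct _ _

mismatch≤1 : ∀ d d' → mismatch d d' ≤ 1
mismatch≤1 R R = z≤n
mismatch≤1 U U = z≤n
mismatch≤1 R U = ℕP.≤-refl
mismatch≤1 U R = ℕP.≤-refl

module _ (d : Dir) (ds : List Dir) where

  private
    n a b : ℕ
    n = length ds
    a = mismatch d (dir ds 0)
    b = suc n + mismatch d (dir ds n)

    a+count≡ : a + (suc b ∸ a) ≡ suc b
    a+count≡ = ℕP.m+[n∸m]≡n (ℕP.≤-trans (mismatch≤1 d (dir ds 0)) (s≤s z≤n))

  ∈-sideLevels⁻ : ∀ {j} → j ∈ sideLevels d ds → a ≤ j × j ≤ b
  ∈-sideLevels⁻ {j} j∈ with ∈-interval⁻ j∈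
  ... | a≤j , j<end = a≤j , ℕP.≤-pred (subst (j <_) a+count≡ j<end)

  ∈-sideLevels⁺ : ∀ {j} → a ≤ j → j ≤ b → j ∈ sideLevels d ds
  ∈-sideLevels⁺ {j} a≤j j≤b = ∈-interval⁺ a≤j (subst (j <_) (sym a+count≡) (s≤s j≤b))

  inner∈sideLevels : ∀ {j} → 1 ≤ j → j ≤ suc n → j ∈ sideLevels d ds
  inner∈sideLevels 1≤j j≤ = ∈-sideLevels⁺ (ℕP.≤-trans (mismatch≤1 d (dir ds 0)) 1≤j) (ℕP.≤-trans j≤ (ℕP.m≤m+n (suc n) _))

  0∈sideLevels : dir ds 0 ≡ d → 0 ∈ sideLevels d ds
  0∈sideLevels refl = ∈-sideLevels⁺ (ℕP.≤-reflexive (mismatch-refl d)) z≤n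
    where
    mismatch-refl : ∀ d → mismatch d d ≡ 0
    mismatch-refl R = refl
    mismatch-refl U = refl

  0∈sideLevels⁻ : 0 ∈ sideLevels d ds → dir ds 0 ≡ d
  0∈sideLevels⁻ 0∈ = mismatch≡0 d (dir ds 0) (ℕP.n≤0⇒n≡0 (proj₁ (∈-sideLevels⁻ 0∈)))

  top∈sideLevels : dir ds n ≢ d → suc (suc n) ∈ sideLevels d ds
  top∈sideLevels dₙ≢d = ∈-sideLevels⁺ (ℕP.≤-trans (mismatch≤1 d (dir ds 0)) (s≤s z≤n))
                                      (ℕP.≤-reflexive (mismatch≢ d (dir ds n) dₙ≢d))
    where
    mismatch≢ : ∀ d d' → d' ≢ d → suc (suc n) ≡ suc n + mismatch d d'
    mismatch≢ R R ≢ = ⊥-elim (≢ refl)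
    mismatch≢ U U ≢ = ⊥-elim (≢ refl)
    mismatch≢ R U _ = sym (ℕP.+-comm (suc n) 1)
    mismatch≢ U R _ = sym (ℕP.+-comm (suc n) 1)

  top∈sideLevels⁻ : suc (suc n) ∈ sideLevels d ds → dir ds n ≢ d
  top∈sideLevels⁻ top∈ = mismatch≡1 d (dir ds n) (ℕP.≤-antisym (mismatch≤1 d (dir ds n)) (ℕP.+-cancelˡ-≤ (suc n) 1 _ top≤))
    where
    top≤ : suc n + 1 ≤ suc n + mismatch d (dir ds n)
    top≤ = subst (_≤ b) (ℕP.+-comm 1 (suc n)) (proj₂ (∈-sideLevels⁻ top∈))

  ∈-sideLevels⇒≤top : ∀ {j} → j ∈ sideLevels d ds → j ≤ suc (suc n)
  ∈-sideLevels⇒≤top j∈ = ℕP.≤-trans (proj₂ (∈-sideLevels⁻ j∈))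
                                     (subst (b ≤_) (ℕP.+-comm (suc n) 1) (ℕP.+-monoʳ-≤ (suc n) (mismatch≤1 d (dir ds n))))

startLevels : ℕ → List ℕ
startLevels zero = 0 ∷ []
startLevels (suc _) = []

endLevels : ℕ → ℕ → List ℕ
endLevels n zero = []
endLevels n (suc _) = suc (suc n) ∷ []

interval-end : ∀ e n → e ≤ 1 → interval 1 (suc n + e) ≡ interval 1 (suc n) ++ endLevels n e
interval-end zero n _ = trans (cong (interval 1) (ℕP.+-identityʳ (suc n))) (sym (ListP.++-identityʳ _))
interval-end (suc zero) n _ = trans (cong (interval 1) (ℕP.+-comm (suc n) 1)) (interval-∷ʳ 1 (suc n))
interval-end (suc (suc e)) n (s≤s ())

interval-split : ∀ s e n → s ≤ 1 → e ≤ 1 → interval s (suc (suc n + e) ∸ s) ≡ startLevels s ++ (interval 1 (suc n) ++ endLevels n e)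
interval-split zero e n _ e≤1 = cong (0 ∷_) (interval-end e n e≤1)
interval-split (suc zero) e n _ e≤1 = interval-end e n e≤1
interval-split (suc (suc s)) e n (s≤s ()) _

inner-sideVertices : ∀ d ds → map (step d) (tiles ds) ≡ map (sideVertex d ds) (interval 1 (suc (length ds)))
inner-sideVertices d ds = trans (cong (map (step d)) (tiles≡map ds))
  (trans (sym (ListP.map-∘ (interval 0 (suc (length ds))))) (sym (map-interval-suc (sideVertex d ds) 0 (suc (length ds)))))

top-sideVertex : ∀ d ds → dir ds (length ds) ≢ d → sideVertex d ds (suc (suc (length ds))) ≡ upperRight (lastTile ds)
top-sideVertex d ds dₙ≢d rewrite lastTile≡tile ds =
  trans (cong (λ d' → step d (step d' (tile ds (length ds)))) (≢⇒flip dₙ≢d)) (step-flip-step d (tile ds (length ds)))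

module _ (d : Dir) (ds : List Dir) where

  private
    n : ℕ
    n = length ds

  sideBoundary≡ : ∀ {P Q} → P ≡ map (sideVertex d ds) (startLevels (mismatch d (dir ds 0)))
                → Q ≡ map (sideVertex d ds) (endLevels n (mismatch d (dir ds n)))
                → P ++ (map (step d) (tiles ds) ++ Q) ≡ map (sideVertex d ds) (sideLevels d ds)
  sideBoundary≡ {P} {Q} P≡ Q≡ = begin
      P ++ (map (step d) (tiles ds) ++ Q)
    ≡⟨ cong₂ _++_ P≡ (cong₂ _++_ (inner-sideVertices d ds) Q≡) ⟩
      map (sideVertex d ds) start ++ (map (sideVertex d ds) (interval 1 (suc n)) ++ map (sideVertex d ds) end)
    ≡⟨ cong (map (sideVertex d ds) start ++_) (sym (ListP.map-++ (sideVertex d ds) (interval 1 (suc n)) end)) ⟩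
      map (sideVertex d ds) start ++ map (sideVertex d ds) (interval 1 (suc n) ++ end)
    ≡⟨ sym (ListP.map-++ (sideVertex d ds) start _) ⟩
      map (sideVertex d ds) (start ++ (interval 1 (suc n) ++ end))
    ≡⟨ cong (map (sideVertex d ds)) (sym (interval-split _ _ n (mismatch≤1 d (dir ds 0)) (mismatch≤1 d (dir ds n)))) ⟩
      map (sideVertex d ds) (sideLevels d ds)
    ∎
    where
    open ≡-Reasoning
    start = startLevels (mismatch d (dir ds 0))
    end = endLevels n (mismatch d (dir ds n))

  start≡ : ∀ {d₀} → dir ds 0 ≡ d₀ → map (sideVertex d ds) (startLevels (mismatch d d₀))
           ≡ map (sideVertex d ds) (startLevels (mismatch d (dir ds 0)))
  start≡ e = cong (λ d' → map (sideVertex d ds) (startLevels (mismatch d d'))) (sym e)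

  end≡ : ∀ {dₙ} → dir ds n ≡ dₙ → map (sideVertex d ds) (endLevels n (mismatch d dₙ))
         ≡ map (sideVertex d ds) (endLevels n (mismatch d (dir ds n)))
  end≡ e = cong (λ d' → map (sideVertex d ds) (endLevels n (mismatch d d'))) (sym e)

  closing≡ : ∀ {dₙ} → dir ds n ≡ dₙ → dₙ ≢ d
             → upperRight (lastTile ds) ∷ [] ≡ map (sideVertex d ds) (endLevels n (mismatch d (dir ds n)))
  closing≡ e dₙ≢d = trans (cong (_∷ []) (sym (top-sideVertex d ds (λ e' → dₙ≢d (trans (sym e) e')))))
                          (trans (cong (map (sideVertex d ds)) (sym (endLevels-mismatch d _ n dₙ≢d))) (end≡ e))
    where
    endLevels-mismatch : ∀ d d' n → d' ≢ d → endLevels n (mismatch d d') ≡ suc (suc n) ∷ []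
    endLevels-mismatch R R n ≢ = ⊥-elim (≢ refl)
    endLevels-mismatch U U n ≢ = ⊥-elim (≢ refl)
    endLevels-mismatch R U n _ = refl
    endLevels-mismatch U R n _ = refl

upperBoundary≡ : ∀ ds → upperBoundary ds ≡ map (sideVertex U ds) (sideLevels U ds)
upperBoundary≡ ds with firstDir ds | dir-first ds | lastDir ds | dir-last ds
... | just R  | e₀ | just R  | eₙ = sideBoundary≡ U ds (start≡ U ds e₀) (closing≡ U ds eₙ λ ())
... | just R  | e₀ | nothing | eₙ = sideBoundary≡ U ds (start≡ U ds e₀) (closing≡ U ds eₙ λ ())
... | just R  | e₀ | just U  | eₙ = sideBoundary≡ U ds (start≡ U ds e₀) (end≡ U ds eₙ)
... | just U  | e₀ | just R  | eₙ = sideBoundary≡ U ds (start≡ U ds e₀) (closing≡ U ds eₙ λ ())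
... | just U  | e₀ | nothing | eₙ = sideBoundary≡ U ds (start≡ U ds e₀) (closing≡ U ds eₙ λ ())
... | just U  | e₀ | just U  | eₙ = sideBoundary≡ U ds (start≡ U ds e₀) (end≡ U ds eₙ)
... | nothing | e₀ | just R  | eₙ = sideBoundary≡ U ds (start≡ U ds e₀) (closing≡ U ds eₙ λ ())
... | nothing | e₀ | nothing | eₙ = sideBoundary≡ U ds (start≡ U ds e₀) (closing≡ U ds eₙ λ ())
... | nothing | e₀ | just U  | eₙ = sideBoundary≡ U ds (start≡ U ds e₀) (end≡ U ds eₙ)

lowerBoundary≡ : ∀ ds → lowerBoundary ds ≡ map (sideVertex R ds) (sideLevels R ds)
lowerBoundary≡ ds with firstDir ds | dir-first ds | lastDir ds | dir-last ds
... | just R  | e₀ | just R  | eₙ = sideBoundary≡ R ds (start≡ R ds e₀) (end≡ R ds eₙ)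
... | just R  | e₀ | nothing | eₙ = sideBoundary≡ R ds (start≡ R ds e₀) (end≡ R ds eₙ)
... | just R  | e₀ | just U  | eₙ = sideBoundary≡ R ds (start≡ R ds e₀) (closing≡ R ds eₙ λ ())
... | just U  | e₀ | just R  | eₙ = sideBoundary≡ R ds (start≡ R ds e₀) (end≡ R ds eₙ)
... | just U  | e₀ | nothing | eₙ = sideBoundary≡ R ds (start≡ R ds e₀) (end≡ R ds eₙ)
... | just U  | e₀ | just U  | eₙ = sideBoundary≡ R ds (start≡ R ds e₀) (closing≡ R ds eₙ λ ())
... | nothing | e₀ | just R  | eₙ = sideBoundary≡ R ds (start≡ R ds e₀) (end≡ R ds eₙ)
... | nothing | e₀ | nothing | eₙ = sideBoundary≡ R ds (start≡ R ds e₀) (end≡ R ds eₙ)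
... | nothing | e₀ | just U  | eₙ = sideBoundary≡ R ds (start≡ R ds e₀) (closing≡ R ds eₙ λ ())

-- Of the two sides through which a tile can be entered (or left), only the one the snake crosses is signed.
signIf : Dir → Dir → ℤ → ℤ
signIf R R s = s
signIf U U s = s
signIf R U s = 1ℤ
signIf U R s = 1ℤ

signIf-flipˡ : ∀ d s → signIf (flip d) d s ≡ 1ℤ
signIf-flipˡ R s = refl
signIf-flipˡ U s = refl

signIf-flipʳ : ∀ d s → signIf d (flip d) s ≡ 1ℤ
signIf-flipʳ R s = refl
signIf-flipʳ U s = refl

entryEdge∈edges : ∀ ds k → k ≤ length ds → ∀ {p} → tile ds k ≡ p → ∀ d → entryEdge p d ∈ edges ds
entryEdge∈edges ds k k≤n tile≡p R = tileEdge∈edges ds k k≤n tile≡p _ (there (there (here refl)))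
entryEdge∈edges ds k k≤n tile≡p U = tileEdge∈edges ds k k≤n tile≡p _ (here refl)

exitEdge∈edges : ∀ ds k → k ≤ length ds → ∀ {p} → tile ds k ≡ p → ∀ d → exitEdge p d ∈ edges ds
exitEdge∈edges ds k k≤n tile≡p R = tileEdge∈edges ds k k≤n tile≡p _ (there (there (there (here refl))))
exitEdge∈edges ds k k≤n tile≡p U = tileEdge∈edges ds k k≤n tile≡p _ (there (here refl))

edgeLevel-entryEdge : ∀ p d → edgeLevel (entryEdge p d) ≡ level p
edgeLevel-entryEdge (x , y) R = refl
edgeLevel-entryEdge (x , y) U = refl

ver≢hor : ∀ {a b c d} → ver a b ≢ hor c d
ver≢hor ()

hor≢ver : ∀ {a b c d} → hor a b ≢ ver c d
hor≢ver ()

module _ (ds : List Dir) (k : ℕ) (k≤n : k ≤ length ds) where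

  private
    t : Vertex
    t = tile ds k

    entry-signed : ∀ {d} → dir ds (k ∸ 1) ≡ d → signedEdge ds k ≡ entryEdge t d
    entry-signed e = trans (signedEdge≡entryEdge ds k) (cong (entryEdge t) e)

    exit-signed : ∀ {d} → dir ds k ≡ d → signedEdge ds (suc k) ≡ exitEdge t d
    exit-signed e = cong (exitEdge t) e

    level-entry : ∀ d → edgeLevel (entryEdge t d) ≡ k
    level-entry d = trans (edgeLevel-entryEdge t d) (level-tile ds k)

    level-exit : ∀ d → edgeLevel (exitEdge t d) ≡ suc k
    level-exit d = trans (edgeLevel-exitEdge t d) (cong suc (level-tile ds k))

    k≤ : k ≤ suc (length ds)
    k≤ = ℕP.m≤n⇒m≤1+n k≤n

  weight-entryEdge : ∀ d → weight ds (entryEdge t d) ≡ signIf d (dir ds (k ∸ 1)) (sign k)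
  weight-entryEdge R with dir ds (k ∸ 1) in e
  ... | R = weight-on-sequence ds k k≤ (entry-signed e)
  ... | U = weight-off-sequence ds k (level-entry R) (λ eq → ver≢hor (trans eq (entry-signed e)))
  weight-entryEdge U with dir ds (k ∸ 1) in e
  ... | U = weight-on-sequence ds k k≤ (entry-signed e)
  ... | R = weight-off-sequence ds k (level-entry U) (λ eq → hor≢ver (trans eq (entry-signed e)))

  weight-exitEdge : ∀ d → weight ds (exitEdge t d) ≡ signIf d (dir ds k) (sign (suc k))
  weight-exitEdge R with dir ds k in e
  ... | R = weight-on-sequence ds (suc k) (s≤s k≤n) (exit-signed e)
  ... | U = weight-off-sequence ds (suc k) (level-exit R) (λ eq → ver≢hor (trans eq (exit-signed e)))
  weight-exitEdge U with dir ds k in e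
  ... | U = weight-on-sequence ds (suc k) (s≤s k≤n) (exit-signed e)
  ... | R = weight-off-sequence ds (suc k) (level-exit U) (λ eq → hor≢ver (trans eq (exit-signed e)))

sign≡±1 : ∀ k → sign k ≡ 1ℤ ⊎ sign k ≡ -1ℤ
sign≡±1 zero = inj₁ refl
sign≡±1 (suc k) with sign≡±1 k
... | inj₁ s≡1 = inj₂ (cong -_ s≡1)
... | inj₂ s≡-1 = inj₁ (cong -_ s≡-1)

diagonal-cancel : ∀ p q {s} → s ≡ 1ℤ ⊎ s ≡ -1ℤ → signIf U p s *ℤ signIf R q (- s) +ℤ signIf R p s *ℤ signIf U q (- s) ≡ 0ℤ
diagonal-cancel R R (inj₁ refl) = refl
diagonal-cancel R R (inj₂ refl) = refl
diagonal-cancel R U (inj₁ refl) = refl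
diagonal-cancel R U (inj₂ refl) = refl
diagonal-cancel U R (inj₁ refl) = refl
diagonal-cancel U R (inj₂ refl) = refl
diagonal-cancel U U (inj₁ refl) = refl
diagonal-cancel U U (inj₂ refl) = refl

antidiagonal-cancel : ∀ p q {s} → s ≡ 1ℤ ⊎ s ≡ -1ℤ → signIf R p s *ℤ signIf U p s +ℤ signIf U q (- s) *ℤ signIf R q (- s) ≡ 0ℤ
antidiagonal-cancel R R (inj₁ refl) = refl
antidiagonal-cancel R R (inj₂ refl) = refl
antidiagonal-cancel R U (inj₁ refl) = refl
antidiagonal-cancel R U (inj₂ refl) = refl
antidiagonal-cancel U R (inj₁ refl) = refl
antidiagonal-cancel U R (inj₂ refl) = refl
antidiagonal-cancel U U (inj₁ refl) = refl
antidiagonal-cancel U U (inj₂ refl) = refl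

lowerRight≢upperLeft : ∀ p → lowerRight p ≢ upperLeft p
lowerRight≢upperLeft (x , y) eq = ℕP.1+n≢n (cong proj₁ eq)

upperRight≢self : ∀ p → upperRight p ≢ p
upperRight≢self (x , y) eq = ℕP.1+n≢n (cong proj₁ eq)

-- The signs alternate along the signed sequence, so the two paths of length two between opposite corners of a tile cancel.
module _ (ds : List Dir) {col : Vertex → Bool} (proper : ProperColouring ds col) (k : ℕ) (k≤n : k ≤ length ds) where

  private
    t : Vertex
    t = tile ds k

  BBᵀ-diagonal : col t ≡ true → BBᵀ ds col t (upperRight t) ≡ 0ℤ
  BBᵀ-diagonal black = begin
      BBᵀ ds col t (upperRight t)
    ≡⟨ BBᵀ-two-common ds proper (upperRight t) (lowerRight t) (upperLeft t) black (lowerRight≢upperLeft t) common-⟷-diagonal ⟩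
      BBᵀterm ds t (upperRight t) (lowerRight t) +ℤ BBᵀterm ds t (upperRight t) (upperLeft t)
    ≡⟨ cong₂ _+ℤ_ (BBᵀterm-joins ds (entryEdge∈edges ds k k≤n refl U) (inj₁ refl) (exitEdge∈edges ds k k≤n refl R) (inj₂ refl))
                  (BBᵀterm-joins ds (entryEdge∈edges ds k k≤n refl R) (inj₁ refl) (exitEdge∈edges ds k k≤n refl U) (inj₂ refl)) ⟩
      weight ds (entryEdge t U) *ℤ weight ds (exitEdge t R) +ℤ weight ds (entryEdge t R) *ℤ weight ds (exitEdge t U)
    ≡⟨ cong₂ _+ℤ_ (cong₂ _*ℤ_ (weight-entryEdge ds k k≤n U) (weight-exitEdge ds k k≤n R))
                  (cong₂ _*ℤ_ (weight-entryEdge ds k k≤n R) (weight-exitEdge ds k k≤n U)) ⟩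
      signIf U (dir ds (k ∸ 1)) (sign k) *ℤ signIf R (dir ds k) (sign (suc k))
        +ℤ signIf R (dir ds (k ∸ 1)) (sign k) *ℤ signIf U (dir ds k) (sign (suc k))
    ≡⟨ diagonal-cancel (dir ds (k ∸ 1)) (dir ds k) (sign≡±1 k) ⟩
      0ℤ
    ∎
    where open ≡-Reasoning

  BBᵀ-antidiagonal : col (upperLeft t) ≡ true → BBᵀ ds col (upperLeft t) (lowerRight t) ≡ 0ℤ
  BBᵀ-antidiagonal black = begin
      BBᵀ ds col (upperLeft t) (lowerRight t)
    ≡⟨ BBᵀ-two-common ds proper (lowerRight t) t (upperRight t) black (λ eq → upperRight≢self t (sym eq)) common-⟷-antidiagonal ⟩
      BBᵀterm ds (upperLeft t) (lowerRight t) t +ℤ BBᵀterm ds (upperLeft t) (lowerRight t) (upperRight t)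
    ≡⟨ cong₂ _+ℤ_ (BBᵀterm-joins ds (entryEdge∈edges ds k k≤n refl R) (inj₂ refl) (entryEdge∈edges ds k k≤n refl U) (inj₂ refl))
                  (BBᵀterm-joins ds (exitEdge∈edges ds k k≤n refl U) (inj₁ refl) (exitEdge∈edges ds k k≤n refl R) (inj₁ refl)) ⟩
      weight ds (entryEdge t R) *ℤ weight ds (entryEdge t U) +ℤ weight ds (exitEdge t U) *ℤ weight ds (exitEdge t R)
    ≡⟨ cong₂ _+ℤ_ (cong₂ _*ℤ_ (weight-entryEdge ds k k≤n R) (weight-entryEdge ds k k≤n U))
                  (cong₂ _*ℤ_ (weight-exitEdge ds k k≤n U) (weight-exitEdge ds k k≤n R)) ⟩
      signIf R (dir ds (k ∸ 1)) (sign k) *ℤ signIf U (dir ds (k ∸ 1)) (sign k)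
        +ℤ signIf U (dir ds k) (sign (suc k)) *ℤ signIf R (dir ds k) (sign (suc k))
    ≡⟨ antidiagonal-cancel (dir ds (k ∸ 1)) (dir ds k) (sign≡±1 k) ⟩
      0ℤ
    ∎
    where open ≡-Reasoning

-- A change of direction after tile k makes the upper right corner of tile k a turn, hence black; it is
-- adjacent to the upper left and the lower right corner of tile k, which therefore are white.
module _ (ds : List Dir) {col : Vertex → Bool} (proper : ProperColouring ds col) (turnsBlack : AllTurnsBlack ds col) where

  private
    corner-turn : ∀ k → suc k < length ds → let t = tile ds k in
                  hor (suc (proj₁ t)) (suc (proj₂ t)) ∈ edges ds → ver (suc (proj₁ t)) (suc (proj₂ t)) ∈ edges ds
                → Turn ds (upperRight t)
    corner-turn k k+1<n east∈ north∈ =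
      crossing-turn ds (proj₁ t) (proj₂ t) (exitEdge∈edges ds k k≤n refl U) east∈ (exitEdge∈edges ds k k≤n refl R) north∈
        (subst (2 ≤_) (sym level≡) (s≤s (s≤s z≤n))) (subst (_≤ length ds) (sym level≡) k+1<n)
      where
      t = tile ds k
      k≤n = ℕP.<⇒≤ (ℕP.<-trans (ℕP.n<1+n k) k+1<n)
      level≡ : level (upperRight t) ≡ suc (suc k)
      level≡ = trans (level-upperRight t) (cong (suc ∘ suc) (level-tile ds k))

    turn-at : ∀ k → suc k < length ds → dir ds k ≢ dir ds (suc k) → Turn ds (upperRight (tile ds k))
    turn-at k k+1<n change with dir ds k in e₁ | dir ds (suc k) in e₂
    ... | R | R = ⊥-elim (change refl)
    ... | U | U = ⊥-elim (change refl)
    ... | R | U = corner-turn k k+1<n (exitEdge∈edges ds (suc k) (ℕP.<⇒≤ k+1<n) (tile-suc ds k e₁) U)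
                    (entryEdge∈edges ds (suc (suc k)) k+1<n (trans (tile-suc ds (suc k) e₂) (cong (step U) (tile-suc ds k e₁))) R)
    ... | U | R = corner-turn k k+1<n
                    (entryEdge∈edges ds (suc (suc k)) k+1<n (trans (tile-suc ds (suc k) e₂) (cong (step R) (tile-suc ds k e₁))) U)
                    (exitEdge∈edges ds (suc k) (ℕP.<⇒≤ k+1<n) (tile-suc ds k e₁) R)

  straight-at-black : ∀ k d → col (step d (tile ds k)) ≡ true → dir ds k ≡ dir ds (suc k)
  straight-at-black k d black with dir ds k ≟Dir dir ds (suc k)
  ... | yes straight = straight
  ... | no change = ⊥-elim (colours-differ ds col proper
                               (exitEdge∈edges ds k (ℕP.<⇒≤ (ℕP.<-trans (ℕP.n<1+n k) k+1<n)) refl d) (exitEdge-joins-upperRight (tile ds k) d)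
                               (trans black (sym (turnsBlack _ (turn-at k k+1<n change)))))
    where k+1<n = dir-change⇒inner ds k change

below-top : ∀ d ds k → suc (suc k) ∈ sideLevels d ds → dir ds k ≡ d → suc k ≤ length ds
below-top d ds k k+2∈ dₖ≡d with ℕP.m≤n⇒m<n∨m≡n (ℕP.≤-pred (ℕP.≤-pred (∈-sideLevels⇒≤top d ds k+2∈)))
... | inj₁ k<n = k<n
... | inj₂ refl = ⊥-elim (top∈sideLevels⁻ d ds k+2∈ dₖ≡d)

SideEdge : Dir → List Dir → ℕ → Set
SideEdge d ds j = Σ[ e ∈ Edge ] e ∈ edges ds × Joins e (sideVertex d ds j) (sideVertex d ds (suc j)) × weight ds e ≡ 1ℤ

sideEdge : ∀ d ds j → j ∈ sideLevels d ds → suc j ∈ sideLevels d ds → SideEdge d ds j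
sideEdge d ds zero 0∈ _ =
  entryEdge (0 , 0) (flip d) , entryEdge∈edges ds 0 z≤n refl (flip d) , entryEdge-joins (0 , 0) d ,
  trans (weight-entryEdge ds 0 z≤n (flip d)) (trans (cong (λ d₀ → signIf (flip d) d₀ 1ℤ) (0∈sideLevels⁻ d ds 0∈)) (signIf-flipˡ d 1ℤ))
sideEdge d ds (suc k) _ k+2∈ with dir ds k ≟Dir d
... | yes dₖ≡d =
  entryEdge (tile ds (suc k)) (flip d) , entryEdge∈edges ds (suc k) k+1≤n refl (flip d) ,
  subst (λ p → Joins (entryEdge (tile ds (suc k)) (flip d)) p (sideVertex d ds (suc (suc k))))
        (tile-suc ds k dₖ≡d) (entryEdge-joins (tile ds (suc k)) d) ,
  trans (weight-entryEdge ds (suc k) k+1≤n (flip d)) (trans (cong (λ dₖ → signIf (flip d) dₖ _) dₖ≡d) (signIf-flipˡ d _))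
  where k+1≤n = below-top d ds k k+2∈ dₖ≡d
... | no dₖ≢d =
  exitEdge (tile ds k) d , exitEdge∈edges ds k k≤n refl d ,
  subst (Joins _ (sideVertex d ds (suc k))) (sym (trans (cong (step d) (tile-suc ds k (≢⇒flip dₖ≢d))) (step-flip-step d (tile ds k))))
    (exitEdge-joins-upperRight (tile ds k) d) ,
  trans (weight-exitEdge ds k k≤n d) (trans (cong (λ dₖ → signIf d dₖ _) (≢⇒flip dₖ≢d)) (signIf-flipʳ d _))
  where k≤n = ℕP.≤-pred (ℕP.≤-pred (∈-sideLevels⇒≤top d ds k+2∈))

between∈sideLevels : ∀ d ds {m} → m ∈ sideLevels d ds → suc (suc m) ∈ sideLevels d ds → suc m ∈ sideLevels d ds
between∈sideLevels d ds m∈ m+2∈ =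
  ∈-sideLevels⁺ d ds (ℕP.≤-trans (proj₁ (∈-sideLevels⁻ d ds m∈)) (ℕP.n≤1+n _)) (ℕP.≤-trans (ℕP.n≤1+n _) (proj₂ (∈-sideLevels⁻ d ds m+2∈)))

module _ (ds : List Dir) {col : Vertex → Bool} (proper : ProperColouring ds col) (turnsBlack : AllTurnsBlack ds col) where

  sideDir-straight : ∀ d m → m ∈ sideLevels d ds → col (sideVertex d ds m) ≡ true → sideDir d ds m ≡ sideDir d ds (suc m)
  sideDir-straight d zero 0∈ _ = sym (0∈sideLevels⁻ d ds 0∈)
  sideDir-straight d (suc k) _ black = straight-at-black ds proper turnsBlack k d black

  BBᵀ-along-side : ∀ d m → m ∈ sideLevels d ds → suc (suc m) ∈ sideLevels d ds → col (sideVertex d ds m) ≡ true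
                 → BBᵀ ds col (sideVertex d ds m) (sideVertex d ds (suc (suc m))) ≡ 1ℤ
  BBᵀ-along-side d m m∈ m+2∈ black with between∈sideLevels d ds m∈ m+2∈
  ... | m+1∈ with sideEdge d ds m m∈ m+1∈ | sideEdge d ds (suc m) m+1∈ m+2∈
  ...   | e₀ , e₀∈ , e₀-joins , w₀≡1 | e₁ , e₁∈ , e₁-joins , w₁≡1 = begin
      BBᵀ ds col p (sideVertex d ds (suc (suc m)))
    ≡⟨ BBᵀ-one-common ds proper _ (sideVertex d ds (suc m)) black only-middle ⟩
      BBᵀterm ds p (sideVertex d ds (suc (suc m))) (sideVertex d ds (suc m))
    ≡⟨ BBᵀterm-joins ds e₀∈ e₀-joins e₁∈ (joins-sym e₁-joins) ⟩
      weight ds e₀ *ℤ weight ds e₁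
    ≡⟨ cong₂ _*ℤ_ w₀≡1 w₁≡1 ⟩
      1ℤ
    ∎
    where
    open ≡-Reasoning
    p = sideVertex d ds m
    s = sideDir d ds m
    p₁≡ : sideVertex d ds (suc m) ≡ step s p
    p₁≡ = sideVertex-suc d ds m
    p₂≡ : sideVertex d ds (suc (suc m)) ≡ step s (step s p)
    p₂≡ = trans (sideVertex-suc d ds (suc m)) (cong₂ step (sym (sideDir-straight d m m∈ black)) p₁≡)
    only-middle : ∀ {w} → p ⟷ w → sideVertex d ds (suc (suc m)) ⟷ w → w ≡ sideVertex d ds (suc m)
    only-middle p⟷w q⟷w = trans (common-⟷-straight s p p⟷w (subst (_⟷ _) p₂≡ q⟷w)) (sym p₁≡)

  BBᵀ-across-level : ∀ j → j ∈ sideLevels U ds → j ∈ sideLevels R ds → col (sideVertex U ds j) ≡ true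
                   → BBᵀ ds col (sideVertex U ds j) (sideVertex R ds j) ≡ 0ℤ
  BBᵀ-across-level zero 0∈U 0∈R _ = ⊥-elim (R≢U (trans (sym (0∈sideLevels⁻ R ds 0∈R)) (0∈sideLevels⁻ U ds 0∈U)))
  BBᵀ-across-level (suc k) k+1∈U k+1∈R black with ℕP.m≤n⇒m<n∨m≡n (ℕP.≤-pred (∈-sideLevels⇒≤top U ds k+1∈U))
  ... | inj₁ k<n+1 = BBᵀ-antidiagonal ds proper k (ℕP.≤-pred k<n+1) black
  ... | inj₂ refl with dir ds (length ds) ≟Dir U
  ...   | yes dₙ≡U = ⊥-elim (top∈sideLevels⁻ U ds k+1∈U dₙ≡U)
  ...   | no dₙ≢U = ⊥-elim (top∈sideLevels⁻ R ds k+1∈R (≢⇒flip dₙ≢U))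

  BBᵀ-across-side : ∀ d m → m ∈ sideLevels d ds → suc (suc m) ∈ sideLevels (flip d) ds → col (sideVertex d ds m) ≡ true
                  → BBᵀ ds col (sideVertex d ds m) (sideVertex (flip d) ds (suc (suc m))) ≡ 0ℤ
  BBᵀ-across-side d zero 0∈ _ black =
    subst (λ q → BBᵀ ds col (0 , 0) q ≡ 0ℤ)
          (sym (trans (cong (step (flip d)) (tile-suc ds 0 (0∈sideLevels⁻ d ds 0∈))) (step-step-flip d (0 , 0))))
          (BBᵀ-diagonal ds proper 0 z≤n black)
  BBᵀ-across-side d (suc k) _ k+3∈ black with dir ds k ≟Dir d
  ... | yes dₖ≡d =
    subst₂ (λ p q → BBᵀ ds col p q ≡ 0ℤ) t₁≡
           (sym (trans (cong (step (flip d)) (tile-suc ds (suc k) dₖ₊₁≡d)) (step-step-flip d (tile ds (suc k)))))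
           (BBᵀ-diagonal ds proper (suc k) k+1≤n (subst (λ p → col p ≡ true) (sym t₁≡) black))
    where
    dₖ₊₁≡d = trans (sym (straight-at-black ds proper turnsBlack k d black)) dₖ≡d
    t₁≡ : tile ds (suc k) ≡ sideVertex d ds (suc k)
    t₁≡ = tile-suc ds k dₖ≡d
    k+1≤n = ℕP.≤-pred (ℕP.≤-pred (∈-sideLevels⇒≤top (flip d) ds k+3∈))
  ... | no dₖ≢d = BBᵀ-no-common ds col _ _ (λ p⟷w q⟷w → no-common-far d (tile ds k) p⟷w (subst (_⟷ _) far≡ q⟷w))
    where
    f = flip d
    dₖ₊₁≡f = trans (sym (straight-at-black ds proper turnsBlack k d black)) (≢⇒flip dₖ≢d)
    far≡ : sideVertex f ds (suc (suc (suc k))) ≡ step f (step f (step f (tile ds k)))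
    far≡ = cong (step f) (trans (tile-suc ds (suc k) dₖ₊₁≡f) (cong (step f) (tile-suc ds k (≢⇒flip dₖ≢d))))

filter-map : ∀ {ℓ} {A B : Set} {P : Pred B ℓ} (f : A → B) (P? : Decidable P) xs
           → filter P? (map f xs) ≡ map f (filter (λ x → P? (f x)) xs)
filter-map f P? [] = refl
filter-map f P? (x ∷ xs) with P? (f x)
... | yes _ = cong (f x ∷_) (filter-map f P? xs)
... | no _ = filter-map f P? xs

everyOther : ℕ → ℕ → List ℕ
everyOther c zero = []
everyOther c (suc k) = c ∷ everyOther (suc (suc c)) k

module _ (f : ℕ → Bool) where

  private
    Trues : List ℕ → List ℕ
    Trues = filter (λ l → f l BoolP.≟ true)

  Alternating : ℕ → ℕ → Set
  Alternating a k = ∀ j → a ≤ j → suc j < a + k → f (suc j) ≡ not (f j)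

  private
    alternating-suc : ∀ a k → Alternating a (suc k) → Alternating (suc a) k
    alternating-suc a k alt j a<j j+1<end = alt j (ℕP.<⇒≤ a<j) (subst (suc j <_) (sym (ℕP.+-suc a k)) j+1<end)

    false⇒≢true : ∀ {b} → b ≡ false → b ≢ true
    false⇒≢true refl ()

    alternating-head : ∀ a k → Alternating a (suc (suc k)) → f (suc a) ≡ not (f a)
    alternating-head a k alt = alt a ℕP.≤-refl (subst (suc a <_) (sym (ℕP.+-suc a (suc k))) (s≤s (head<end a k)))

  trues-from-true : ∀ a k → Alternating a k → f a ≡ true → Σ[ k' ∈ ℕ ] Trues (interval a k) ≡ everyOther a k'
  trues-from-false : ∀ a k → Alternating a k → f a ≡ false → Σ[ k' ∈ ℕ ] Trues (interval a k) ≡ everyOther (suc a) k'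
  trues-from-true a zero _ _ = 0 , refl
  trues-from-true a (suc zero) _ fa = 1 , ListP.filter-accept (λ l → f l BoolP.≟ true) fa
  trues-from-true a (suc (suc k)) alt fa with trues-from-false (suc a) (suc k) (alternating-suc a (suc k) alt)
                                                (trans (alternating-head a k alt) (cong not fa))
  ... | k' , eq = suc k' , trans (ListP.filter-accept (λ l → f l BoolP.≟ true) fa) (cong (a ∷_) eq)
  trues-from-false a zero _ _ = 0 , refl
  trues-from-false a (suc zero) _ fa = 0 , ListP.filter-reject (λ l → f l BoolP.≟ true) (false⇒≢true fa)
  trues-from-false a (suc (suc k)) alt fa with trues-from-true (suc a) (suc k) (alternating-suc a (suc k) alt)
                                                (trans (alternating-head a k alt) (cong not fa))
  ... | k' , eq = k' , trans (ListP.filter-reject (λ l → f l BoolP.≟ true) (false⇒≢true fa)) eq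

  trues-everyOther : ∀ a k → Alternating a k → Σ[ c ∈ ℕ ] Σ[ k' ∈ ℕ ] Trues (interval a k) ≡ everyOther c k'
  trues-everyOther a k alt with f a in fa
  ... | true = a , trues-from-true a k alt fa
  ... | false = suc a , trues-from-false a k alt fa

+2*-suc : ∀ c t → c + 2 * suc t ≡ suc (suc c) + 2 * t
+2*-suc c t = trans (cong (λ z → c + z) (ℕP.*-suc 2 t)) (trans (sym (ℕP.+-assoc c 2 (2 * t))) (cong (_+ 2 * t) (ℕP.+-comm c 2)))

lookup-map-everyOther : ∀ {A : Set} (F : ℕ → A) c k (i : Fin (length (map F (everyOther c k))))
                      → lookup (map F (everyOther c k)) i ≡ F (c + 2 * toℕ i) × c + 2 * toℕ i ∈ everyOther c k
lookup-map-everyOther F c (suc k) fzero = cong F (sym (ℕP.+-identityʳ c)) , here (ℕP.+-identityʳ c)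
lookup-map-everyOther F c (suc k) (fsuc i) with lookup-map-everyOther F (suc (suc c)) k i
... | lookup≡ , ∈ = trans lookup≡ (cong F (sym (+2*-suc c (toℕ i)))) , there (subst (_∈ everyOther (suc (suc c)) k) (sym (+2*-suc c (toℕ i))) ∈)

blackLevels : Dir → List Dir → (Vertex → Bool) → List ℕ
blackLevels d ds col = filter (λ l → col (sideVertex d ds l) BoolP.≟ true) (sideLevels d ds)

upperBlack≡ : ∀ ds col → upperBlack ds col ≡ map (sideVertex U ds) (blackLevels U ds col)
upperBlack≡ ds col = trans (cong (blackOf col) (upperBoundary≡ ds)) (filter-map (sideVertex U ds) _ (sideLevels U ds))

lowerBlack≡ : ∀ ds col → lowerBlack ds col ≡ map (sideVertex R ds) (blackLevels R ds col)
lowerBlack≡ ds col = trans (cong (blackOf col) (lowerBoundary≡ ds)) (filter-map (sideVertex R ds) _ (sideLevels R ds))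

∈-blackLevels⁻ : ∀ d ds col {l} → l ∈ blackLevels d ds col → l ∈ sideLevels d ds × col (sideVertex d ds l) ≡ true
∈-blackLevels⁻ d ds col = ∈-filter⁻ (λ l → col (sideVertex d ds l) BoolP.≟ true)

sideVertex-injective : ∀ d ds {l l'} → sideVertex d ds l ≡ sideVertex d ds l' → l ≡ l'
sideVertex-injective d ds {l} {l'} eq = trans (sym (level-sideVertex d ds l)) (trans (cong level eq) (level-sideVertex d ds l'))

sides-disjoint : ∀ ds {l l'} → l ∈ sideLevels U ds → l' ∈ sideLevels R ds → sideVertex U ds l ≢ sideVertex R ds l'
sides-disjoint ds {l} {l'} l∈ l'∈ eq with trans (sym (level-sideVertex U ds l)) (trans (cong level eq) (level-sideVertex R ds l'))
sides-disjoint ds {zero} l∈ l'∈ eq | refl = R≢U (trans (sym (0∈sideLevels⁻ R ds l'∈)) (0∈sideLevels⁻ U ds l∈))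
sides-disjoint ds {suc k} l∈ l'∈ eq | refl = lowerRight≢upperLeft (tile ds k) (sym eq)

sideVertex∈vertices : ∀ d ds {l} → l ∈ sideLevels d ds → sideVertex d ds l ∈ vertices ds
sideVertex∈vertices d ds {zero} _ = corner∈vertices ds (tile ds 0) _ (tile∈tiles ds 0 z≤n) (here refl)
sideVertex∈vertices d ds {suc k} k+1∈ with ℕP.m≤n⇒m<n∨m≡n (ℕP.≤-pred (∈-sideLevels⇒≤top d ds k+1∈))
... | inj₁ k<n+1 = corner∈vertices ds (tile ds k) _ (tile∈tiles ds k (ℕP.≤-pred k<n+1)) (step∈tileCorners d (tile ds k))
  where
  step∈tileCorners : ∀ d p → step d p ∈ tileCorners p
  step∈tileCorners R (x , y) = there (here refl)
  step∈tileCorners U (x , y) = there (there (here refl))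
... | inj₂ refl = subst (_∈ vertices ds) (sym (trans (top-sideVertex d ds (top∈sideLevels⁻ d ds k+1∈)) (cong upperRight (lastTile≡tile ds))))
                        (corner∈vertices ds (tile ds (length ds)) _ (tile∈tiles ds _ ℕP.≤-refl) (there (there (there (here refl)))))

OnBoundary : List Dir → Vertex → Set
OnBoundary ds v = Σ[ d ∈ Dir ] Σ[ l ∈ ℕ ] l ∈ sideLevels d ds × v ≡ sideVertex d ds l

corner-onBoundary : ∀ ds k → k ≤ length ds → ∀ v → v ∈ tileCorners (tile ds k) → OnBoundary ds v
corner-onBoundary ds zero _ _ (here refl) = dir ds 0 , 0 , 0∈sideLevels (dir ds 0) ds refl , refl
corner-onBoundary ds (suc k) k+1≤n _ (here refl) = dir ds k , suc k , inner∈sideLevels (dir ds k) ds (s≤s z≤n) (ℕP.m≤n⇒m≤1+n k+1≤n) , refl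
corner-onBoundary ds k k≤n _ (there (here refl)) = R , suc k , inner∈sideLevels R ds (s≤s z≤n) (s≤s k≤n) , refl
corner-onBoundary ds k k≤n _ (there (there (here refl))) = U , suc k , inner∈sideLevels U ds (s≤s z≤n) (s≤s k≤n) , refl
corner-onBoundary ds k k≤n _ (there (there (there (here refl)))) =
  flip (dir ds k) , suc (suc k) , k+2∈ , sym (trans (cong (step (flip (dir ds k))) refl) (step-step-flip (dir ds k) (tile ds k)))
  where
  k+2∈ : suc (suc k) ∈ sideLevels (flip (dir ds k)) ds
  k+2∈ with ℕP.m≤n⇒m<n∨m≡n k≤n
  ... | inj₁ k<n = inner∈sideLevels _ ds (s≤s z≤n) (s≤s k<n)
  ... | inj₂ refl = top∈sideLevels _ ds (flip-≢ (dir ds (length ds)))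
    where
    flip-≢ : ∀ d → d ≢ flip d
    flip-≢ R ()
    flip-≢ U ()

module _ (ds : List Dir) (col : Vertex → Bool) where

  private
    Black? = λ (v : Vertex) → col v BoolP.≟ true

  black-onBoundary : ∀ {v} → OnBoundary ds v → col v ≡ true → v ∈ upperBlack ds col ++ lowerBlack ds col
  black-onBoundary (U , l , l∈ , refl) black =
    ∈-++⁺ˡ (subst (_ ∈_) (sym (upperBlack≡ ds col)) (∈-map⁺ (sideVertex U ds) (∈-filter⁺ _ l∈ black)))
  black-onBoundary (R , l , l∈ , refl) black =
    ∈-++⁺ʳ (upperBlack ds col) (subst (_ ∈_) (sym (lowerBlack≡ ds col)) (∈-map⁺ (sideVertex R ds) (∈-filter⁺ _ l∈ black)))

  blackOrdering-valid : ValidBlackOrdering ds col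
  blackOrdering-valid = all-vertices , unique , complete
    where
    onSide⇒vertex : ∀ d {v} → v ∈ map (sideVertex d ds) (blackLevels d ds col) → v ∈ vertices ds
    onSide⇒vertex d v∈ with ∈-map⁻ (sideVertex d ds) v∈
    ... | l , l∈ , refl = sideVertex∈vertices d ds (proj₁ (∈-blackLevels⁻ d ds col l∈))

    all-vertices : All (_∈ vertices ds) (upperBlack ds col ++ lowerBlack ds col)
    all-vertices rewrite upperBlack≡ ds col | lowerBlack≡ ds col =
      AllP.++⁺ (All.tabulate (onSide⇒vertex U)) (All.tabulate (onSide⇒vertex R))

    side-unique : ∀ d → Unique (map (sideVertex d ds) (blackLevels d ds col))
    side-unique d = UniqueP.map⁺ (sideVertex-injective d ds)
                    (UniqueP.filter⁺ (λ l → col (sideVertex d ds l) BoolP.≟ true) (sideLevels-distinct d ds))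

    unique : Unique (upperBlack ds col ++ lowerBlack ds col)
    unique rewrite upperBlack≡ ds col | lowerBlack≡ ds col = UniqueP.++⁺ (side-unique U) (side-unique R) disjoint
      where
      disjoint : ∀ {v} → ¬ (v ∈ map (sideVertex U ds) (blackLevels U ds col) × v ∈ map (sideVertex R ds) (blackLevels R ds col))
      disjoint (vU , vR) with ∈-map⁻ (sideVertex U ds) vU | ∈-map⁻ (sideVertex R ds) vR
      ... | l , l∈ , refl | l' , l'∈ , eq = sides-disjoint ds (proj₁ (∈-blackLevels⁻ U ds col l∈)) (proj₁ (∈-blackLevels⁻ R ds col l'∈)) eq

    complete : ∀ v → v ∈ vertices ds → col v ≡ true → v ∈ upperBlack ds col ++ lowerBlack ds col
    complete v v∈ black with vertex⇒corner ds v v∈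
    ... | k , k≤n , v∈corners = black-onBoundary (corner-onBoundary ds k k≤n v v∈corners) black

BBᵀ-level-gap : ∀ ds col b b' → 3 + level b ≤ level b' → BBᵀ ds col b b' ≡ 0ℤ
BBᵀ-level-gap ds col b b' gap = BBᵀ-far-levels ds col b b'
  (λ eq → ℕP.<-irrefl eq b<b')
  (λ eq → ℕP.<-irrefl eq gap)
  (λ eq → ℕP.<-irrefl (sym eq) (ℕP.≤-trans b<b' (ℕP.m≤n+m (level b') 2)))
  where
  b<b' : level b < level b'
  b<b' = ℕP.<-≤-trans (s≤s (ℕP.m≤n+m (level b) 2)) gap

everyOther-gap : ∀ c i j → suc i < j → 3 + (c + 2 * i) ≤ c + 2 * j
everyOther-gap c i j i+1<j = ℕP.≤-trans (ℕP.n≤1+n _) (subst (_≤ c + 2 * j) (trans (+2*-suc c (suc i)) (cong (suc ∘ suc) (+2*-suc c i)))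
                                                              (ℕP.+-monoʳ-≤ c (ℕP.*-monoʳ-≤ 2 i+1<j)))

module _ (ds : List Dir) {col : Vertex → Bool} (proper : ProperColouring ds col) (turnsBlack : AllTurnsBlack ds col) where

  sideLevels-alternating : ∀ d {a k} → interval a k ≡ sideLevels d ds → Alternating (λ l → col (sideVertex d ds l)) a k
  sideLevels-alternating d eq j a≤j j+1<end with sideEdge d ds j (subst (j ∈_) eq (∈-interval⁺ a≤j (ℕP.<-trans (ℕP.n<1+n j) j+1<end)))
                                                               (subst (suc j ∈_) eq (∈-interval⁺ (ℕP.≤-trans a≤j (ℕP.n≤1+n j)) j+1<end))
  ... | _ , e∈ , e-joins , _ = BoolP.¬-not (λ eq' → colours-differ ds col proper e∈ e-joins (sym eq'))

  black-positions : ∀ d L → L ≡ map (sideVertex d ds) (blackLevels d ds col)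
                  → Σ[ c ∈ ℕ ]
                                ∀ (i : Fin (length L)) → lookup L i ≡ sideVertex d ds (c + 2 * toℕ i) × c + 2 * toℕ i ∈ blackLevels d ds col
  black-positions d L refl
    with blackLevels d ds col | trues-everyOther (λ l → col (sideVertex d ds l)) _ _ (sideLevels-alternating d refl)
  ... | .(everyOther c k) | c , k , refl = c , lookup-map-everyOther (sideVertex d ds) c k

  side-tridiagonal : ∀ d L → L ≡ map (sideVertex d ds) (blackLevels d ds col)
                    → TridiagonalOnes {length L} (λ i j → BBᵀ ds col (lookup L i) (lookup L j))
  side-tridiagonal d L L≡ i j with black-positions d L L≡
  ... | c , position = (λ i+1≡j → adjacent i+1≡j , trans (BBᵀ-sym ds col _ _) (adjacent i+1≡j))
                     , (λ i+1<j → apart i+1<j , trans (BBᵀ-sym ds col _ _) (apart i+1<j))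
    where
    l l' : ℕ
    l = c + 2 * toℕ i
    l' = c + 2 * toℕ j
    adjacent : suc (toℕ i) ≡ toℕ j → BBᵀ ds col (lookup L i) (lookup L j) ≡ 1ℤ
    adjacent i+1≡j = trans (cong₂ (BBᵀ ds col) (proj₁ (position i)) (trans (proj₁ (position j)) (cong (sideVertex d ds) l'≡)))
      (BBᵀ-along-side ds proper turnsBlack d l (proj₁ (∈-blackLevels⁻ d ds col (proj₂ (position i))))
        (subst (_∈ sideLevels d ds) l'≡ (proj₁ (∈-blackLevels⁻ d ds col (proj₂ (position j)))))
        (proj₂ (∈-blackLevels⁻ d ds col (proj₂ (position i)))))
      where
      l'≡ : l' ≡ suc (suc l)
      l'≡ = trans (cong (λ t → c + 2 * t) (sym i+1≡j)) (+2*-suc c (toℕ i))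
    apart : suc (toℕ i) < toℕ j → BBᵀ ds col (lookup L i) (lookup L j) ≡ 0ℤ
    apart i+1<j = trans (cong₂ (BBᵀ ds col) (proj₁ (position i)) (proj₁ (position j)))
      (BBᵀ-level-gap ds col _ _ (subst₂ (λ a b → 3 + a ≤ b) (sym (level-sideVertex d ds l)) (sym (level-sideVertex d ds l'))
                                        (everyOther-gap c (toℕ i) (toℕ j) i+1<j)))

  sides-orthogonal : ∀ {l l'} → l ∈ blackLevels U ds col → l' ∈ blackLevels R ds col
                   → BBᵀ ds col (sideVertex U ds l) (sideVertex R ds l') ≡ 0ℤ
  sides-orthogonal {l} {l'} l∈ l'∈ with ∈-blackLevels⁻ U ds col l∈ | ∈-blackLevels⁻ R ds col l'∈ | l ℕP.≟ l'
  ... | l∈U , black | l'∈R , _ | yes refl = BBᵀ-across-level ds proper turnsBlack l l∈U l'∈R black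
  ... | l∈U , black | l'∈R , black' | no l≢l' with suc (suc l) ℕP.≟ l' | suc (suc l') ℕP.≟ l
  ...   | yes refl | _ = BBᵀ-across-side ds proper turnsBlack U l l∈U l'∈R black
  ...   | no _ | yes refl = trans (BBᵀ-sym ds col _ _) (BBᵀ-across-side ds proper turnsBlack R l' l'∈R l∈U black')
  ...   | no l+2≢l' | no l'+2≢l = BBᵀ-far-levels ds col _ _
          (λ eq → l≢l' (trans (sym (level-sideVertex U ds l)) (trans eq (level-sideVertex R ds l'))))
          (λ eq → l+2≢l' (trans (cong (suc ∘ suc) (sym (level-sideVertex U ds l))) (trans eq (level-sideVertex R ds l'))))
          (λ eq → l'+2≢l (trans (cong (suc ∘ suc) (sym (level-sideVertex R ds l'))) (trans eq (level-sideVertex U ds l))))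

  upper-lower-orthogonal : ∀ i j → BBᵀ ds col (lookup (upperBlack ds col) i) (lookup (lowerBlack ds col) j) ≡ 0ℤ
  upper-lower-orthogonal i j with black-positions U _ (upperBlack≡ ds col) | black-positions R _ (lowerBlack≡ ds col)
  ... | _ , upper-at | _ , lower-at = trans (cong₂ (BBᵀ ds col) (proj₁ (upper-at i)) (proj₁ (lower-at j)))
                                            (sides-orthogonal (proj₂ (upper-at i)) (proj₂ (lower-at j)))

BBᵀon : List Dir → (Vertex → Bool) → (L : List Vertex) → Matrix (length L)
BBᵀon ds col L i j = BBᵀ ds col (lookup L i) (lookup L j)

BBᵀordered≡blockDiag : ∀ ds col → (∀ i j → BBᵀ ds col (lookup (upperBlack ds col) i) (lookup (lowerBlack ds col) j) ≡ 0ℤ)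
                     → ∀ i j → BBᵀordered ds col i j
                       ≡ blockDiag (BBᵀon ds col (upperBlack ds col)) (BBᵀon ds col (lowerBlack ds col)) i j
BBᵀordered≡blockDiag ds col orthogonal i j with splitAt (length (upperBlack ds col)) i | splitAt (length (upperBlack ds col)) j
... | inj₁ i' | inj₁ j' = refl
... | inj₂ i' | inj₂ j' = refl
... | inj₁ i' | inj₂ j' = orthogonal i' j'
... | inj₂ i' | inj₁ j' = trans (BBᵀ-sym ds col _ _) (orthogonal j' i')

proposition2p25 : (ds : List Dir) (col : Vertex → Bool)
    → ProperColouring ds col
    → AllTurnsBlack ds col
    → ValidBlackOrdering ds col
    × Σ (Matrix (length (upperBlack ds col))) (λ B₁ →
    Σ (Matrix (length (lowerBlack ds col))) (λ B₂ →
    TridiagonalOnes B₁ × TridiagonalOnes B₂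
    × (∀ i j → BBᵀordered ds col i j ≡ blockDiag B₁ B₂ i j)))
proposition2p25 ds col proper turnsBlack =
    blackOrdering-valid ds col
  , BBᵀon ds col (upperBlack ds col) , BBᵀon ds col (lowerBlack ds col)
  , side-tridiagonal ds proper turnsBlack U _ (upperBlack≡ ds col)
  , side-tridiagonal ds proper turnsBlack R _ (lowerBlack≡ ds col)
  , BBᵀordered≡blockDiag ds col (upper-lower-orthogonal ds proper turnsBlack)
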